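{- Let $\ell(k) := \lim_{n\to\infty} P(2n-1-|S-S| = k)$ for $S$ a uniformly random subset of $[n]$ (this limit exists for each $k \ge 0$), and for positive integers $m$ and integers $k\ge 0$ let \[ f_k(m) := P_{S\subseteq[2m]}\big(|(S-S)\cap\{m,m+1,\dots,2m-1\}| = m-k\big), \] where $S$ is a uniformly random subset of $[2m]$. Then for all integers $k\ge 0$ and all integers $m>k$, \[ |\ell(2k) - f_k(m)| \le 4\left(\tfrac{3}{4}\right)^{m+1}. \]
   Context: For a positive integer $n$, $[n] := \{0,1,\dots,n-1\}$; random subsets are uniform over all $2^n$ subsets. $S-S := \{x-y : x,y\in S\}$. -}

module Defs where

open import Data.Nat as ℕ using (ℕ; zero; suc; _∸_)
open import Data.Integer as ℤ using (ℤ; +_)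
open import Data.Rational as ℚ using (ℚ)
open import Data.Bool using (true; false)
open import Data.Vec using (Vec; []; _∷_)
open import Data.List using (List; []; _∷_; _++_; map; length; filter; upTo)
open import Data.Fin using (Fin; toℕ)
open import Data.Fin.Subset using (Subset; _∈_)
open import Data.Fin.Subset.Properties using (_∈?_)
open import Data.Fin.Properties using (any?)
open import Data.Product using (∃; _×_; _,_)
open import Relation.Nullary using (Dec)
open import Relation.Nullary.Decidable using (_×-dec_)
open import Relation.Binary.PropositionalEquality using (_≡_)

allSubsets : (n : ℕ) → List (Subset n)
allSubsets zero = [] ∷ []
allSubsets (suc n) = map (true ∷_) (allSubsets n) ++ map (false ∷_) (allSubsets n)

_∈Diff_ : ℤ → {n : ℕ} → Subset n → Set
d ∈Diff S = ∃ λ x → ∃ λ y → x ∈ S × y ∈ S × ((+ toℕ x) ℤ.- (+ toℕ y) ≡ d)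

_∈Diff?_ : (d : ℤ) → {n : ℕ} → (S : Subset n) → Dec (d ∈Diff S)
d ∈Diff? S = any? λ x → any? λ y → (x ∈? S) ×-dec ((y ∈? S) ×-dec ((+ toℕ x) ℤ.- (+ toℕ y) ℤ.≟ d))

-- |S - S| for S ⊆ [n]: S - S ⊆ {-n, ..., n}, so count over that range.
diffSize : {n : ℕ} → Subset n → ℕ
diffSize {n} S = length (filter (λ d → d ∈Diff? S)
                   (map (λ i → (+ i) ℤ.- (+ n)) (upTo (suc (2 ℕ.* n)))))

upperDiffSize : (m : ℕ) → Subset (2 ℕ.* m) → ℕ
upperDiffSize m S = length (filter (λ d → (+ d) ∈Diff? S) (map (m ℕ.+_) (upTo m)))

countSubsets : (n : ℕ) {P : Subset n → Set} → ((S : Subset n) → Dec (P S)) → ℕ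
countSubsets n P? = length (filter P? (allSubsets n))

_^ℚ_ : ℚ → ℕ → ℚ
q ^ℚ zero = ℚ.1ℚ
q ^ℚ suc n = q ℚ.* (q ^ℚ n)

prob : (n : ℕ) {P : Subset n → Set} → ((S : Subset n) → Dec (P S)) → ℚ
prob n P? = ((+ countSubsets n P?) ℚ./ 1) ℚ.* (((+ 1) ℚ./ 2) ^ℚ n)

P : ℕ → ℕ → ℚ
P n k = prob n (λ S → ((+ (2 ℕ.* n)) ℤ.- (+ 1) ℤ.- (+ diffSize S)) ℤ.≟ (+ k))

-- f_k(m) = P_{S ⊆ [2m]} (|(S - S) ∩ {m, ..., 2m-1}| = m - k)   (used only for m > k)
f : ℕ → ℕ → ℚ
f k m = prob (2 ℕ.* m) (λ S → upperDiffSize m S ℕ.≟ (m ∸ k))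

-- Write n = 2m + r and cut S ⊆ [n] into u ++ w ++ v with |u| = |v| = m, |w| = r.  Call S good
-- when every d < m + r lies in S - S.  For good S, |S - S| = 2n - 1 - 2k says exactly that m - k
-- of the differences m + r, …, 2m + r - 1 occur, and such large differences only see u and v
-- (shifted by r); so on good sets the event of P n (2k) is the event of f_k(m) for u ++ v, w
-- being free.  Hence |P n (2k) - f_k(m)| is at most the probability that S is bad, bounded by
-- summing over d < m + r the probability that d ∉ S - S.  The pairs {x, x + d} inside a window
-- of length 2d are disjoint, and each avoids being inside S with probability 3/4: for d ≥ n/2
-- this gives (3/4)^(n - d), which sums to at most 4 (3/4)^(m+1); for d < n/2 the windows can
-- be repeated, giving a bound exponentially small in n, so these at most n terms eventually
-- contribute less than ε.
module Submission where

open import Data.Bool using (Bool; true; false; not; _∧_; _∨_; if_then_else_)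
open import Data.Bool.Properties using (∧-conicalˡ; ∧-conicalʳ)
open import Data.Empty using (⊥-elim)
open import Data.Fin using (Fin; toℕ) renaming (zero to fzero; suc to fsuc)
open import Data.Fin.Subset using (Subset; _∈_)
open import Data.Product using (Σ; ∃; ∃-syntax; _×_; _,_; proj₁; proj₂)
open import Data.Vec using ([]; _∷_; _++_; here; there)
open import Relation.Binary.PropositionalEquality
open import Relation.Nullary using (Dec; yes; no; does)
open import Relation.Nullary.Decidable using (isYes; dec-true; does-⇔)
open import Function.Bundles using (_⇔_; mk⇔; Equivalence)

open import Defs

module RationalBounds where

  open import Data.Nat as ℕ using (ℕ; zero; suc; _^_; NonZero)
  import Data.Nat.Properties as ℕₚ
  open import Data.Integer as ℤ using (+_; +[1+_]; -[1+_])
  import Data.Integer.Properties as ℤₚ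
  open import Data.Integer.Tactic.RingSolver using (solve-∀)
  open import Data.Rational as Q
    using (ℚ; mkℚ; _/_; ∣_∣; -_; _+_; _-_; _*_; 0ℚ; 1ℚ; _≤_; _<_; Positive; NonNegative; toℚᵘ)
  import Data.Rational.Properties as Qₚ
  import Data.Rational.Unnormalised as Qᵘ
  import Data.Rational.Unnormalised.Properties as Qᵘₚ
  open import Data.Sum using (inj₁; inj₂)
  open import Data.Rational.Solver using (module +-*-Solver)
  open +-*-Solver using (solve; _:+_; _:-_; _:*_; :-_; _:=_)

  ι : ℕ → ℚ
  ι a = + a / 1

  ½ : ℚ
  ½ = + 1 / 2

  ¾ : ℚ
  ¾ = + 3 / 4

  private
    ι≃ : ∀ a → toℚᵘ (ι a) Qᵘ.≃ Qᵘ.mkℚᵘ (+ a) 0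
    ι≃ a = Qₚ.toℚᵘ-fromℚᵘ (Qᵘ.mkℚᵘ (+ a) 0)

  ι-+ : ∀ a b → ι (a ℕ.+ b) ≡ ι a + ι b
  ι-+ a b = Qₚ.toℚᵘ-injective (begin
    toℚᵘ (ι (a ℕ.+ b))                              ≈⟨ ι≃ (a ℕ.+ b) ⟩
    Qᵘ.mkℚᵘ (+ (a ℕ.+ b)) 0                         ≈⟨ Qᵘ.*≡* (cong (ℤ._* + 1) (trans (ℤₚ.pos-+ a b) (identity (+ a) (+ b)))) ⟩
    Qᵘ.mkℚᵘ (+ a) 0 Qᵘ.+ Qᵘ.mkℚᵘ (+ b) 0            ≈⟨ Qᵘₚ.+-cong (ι≃ a) (ι≃ b) ⟨
    toℚᵘ (ι a) Qᵘ.+ toℚᵘ (ι b)                      ≈⟨ Qₚ.toℚᵘ-homo-+ (ι a) (ι b) ⟨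
    toℚᵘ (ι a + ι b)                                ∎)
    where
    open Qᵘₚ.≃-Reasoning
    identity : ∀ x y → x ℤ.+ y ≡ x ℤ.* + 1 ℤ.+ y ℤ.* + 1
    identity = solve-∀

  ι-* : ∀ a b → ι (a ℕ.* b) ≡ ι a * ι b
  ι-* a b = Qₚ.toℚᵘ-injective (begin
    toℚᵘ (ι (a ℕ.* b))                              ≈⟨ ι≃ (a ℕ.* b) ⟩
    Qᵘ.mkℚᵘ (+ (a ℕ.* b)) 0                         ≈⟨ Qᵘ.*≡* (cong (ℤ._* + 1) (ℤₚ.pos-* a b)) ⟩
    Qᵘ.mkℚᵘ (+ a) 0 Qᵘ.* Qᵘ.mkℚᵘ (+ b) 0            ≈⟨ Qᵘₚ.*-cong (ι≃ a) (ι≃ b) ⟨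
    toℚᵘ (ι a) Qᵘ.* toℚᵘ (ι b)                      ≈⟨ Qₚ.toℚᵘ-homo-* (ι a) (ι b) ⟨
    toℚᵘ (ι a * ι b)                                ∎)
    where open Qᵘₚ.≃-Reasoning

  ι-mono-≤ : ∀ {a b} → a ℕ.≤ b → ι a ≤ ι b
  ι-mono-≤ {a} {b} a≤b = Qₚ.toℚᵘ-cancel-≤
    (Qᵘₚ.≤-respʳ-≃ (Qᵘₚ.≃-sym (ι≃ b)) (Qᵘₚ.≤-respˡ-≃ (Qᵘₚ.≃-sym (ι≃ a))
      (Qᵘ.*≤* (subst₂ ℤ._≤_ (sym (ℤₚ.*-identityʳ (+ a))) (sym (ℤₚ.*-identityʳ (+ b))) (ℤ.+≤+ a≤b)))))

  ι-pos : ∀ a .{{_ : NonZero a}} → Positive (ι a)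
  ι-pos (suc a) = Qₚ.normalize-pos (suc a) 1

  ι-nonNeg : ∀ a → NonNegative (ι a)
  ι-nonNeg a = Qₚ.normalize-nonNeg a 1

  ^ℚ-distribʳ-* : ∀ p q n → (p * q) ^ℚ n ≡ p ^ℚ n * q ^ℚ n
  ^ℚ-distribʳ-* p q zero    = refl
  ^ℚ-distribʳ-* p q (suc n) = trans (cong ((p * q) *_) (^ℚ-distribʳ-* p q n)) (interchange p q _ _)
    where
    interchange : ∀ w x y z → (w * x) * (y * z) ≡ (w * y) * (x * z)
    interchange = solve 4 (λ w x y z → (w :* x) :* (y :* z) := (w :* y) :* (x :* z)) refl

  ^ℚ-distribˡ-+-* : ∀ p a b → p ^ℚ (a ℕ.+ b) ≡ p ^ℚ a * p ^ℚ b
  ^ℚ-distribˡ-+-* p zero    b = sym (Qₚ.*-identityˡ (p ^ℚ b))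
  ^ℚ-distribˡ-+-* p (suc a) b = trans (cong (p *_) (^ℚ-distribˡ-+-* p a b)) (sym (Qₚ.*-assoc p _ _))

  1^ℚn≡1 : ∀ n → 1ℚ ^ℚ n ≡ 1ℚ
  1^ℚn≡1 zero    = refl
  1^ℚn≡1 (suc n) = trans (Qₚ.*-identityˡ (1ℚ ^ℚ n)) (1^ℚn≡1 n)

  ι-^ : ∀ a n → ι (a ^ n) ≡ ι a ^ℚ n
  ι-^ a zero    = refl
  ι-^ a (suc n) = trans (ι-* a (a ^ n)) (cong (ι a *_) (ι-^ a n))

  ½^n*2^n≡1 : ∀ n → ½ ^ℚ n * ι (2 ^ n) ≡ 1ℚ
  ½^n*2^n≡1 n = begin
    ½ ^ℚ n * ι (2 ^ n)   ≡⟨ cong (½ ^ℚ n *_) (ι-^ 2 n) ⟩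
    ½ ^ℚ n * ι 2 ^ℚ n    ≡⟨ ^ℚ-distribʳ-* ½ (ι 2) n ⟨
    1ℚ ^ℚ n              ≡⟨ 1^ℚn≡1 n ⟩
    1ℚ                   ∎
    where open ≡-Reasoning

  ¾^n*4^n≡3^n : ∀ n → ¾ ^ℚ n * ι (4 ^ n) ≡ ι (3 ^ n)
  ¾^n*4^n≡3^n n = begin
    ¾ ^ℚ n * ι (4 ^ n)   ≡⟨ cong (¾ ^ℚ n *_) (ι-^ 4 n) ⟩
    ¾ ^ℚ n * ι 4 ^ℚ n    ≡⟨ ^ℚ-distribʳ-* ¾ (ι 4) n ⟨
    ι 3 ^ℚ n             ≡⟨ ι-^ 3 n ⟨
    ι (3 ^ n)            ∎
    where open ≡-Reasoning

  ≤-by-scaling : ∀ {a b c} N q .{{_ : NonZero c}} →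
    a ℕ.* c ℕ.≤ b ℕ.* 2 ^ N → ι b ≤ q * ι c → ι a * ½ ^ℚ N ≤ q
  ≤-by-scaling {a} {b} {c} N q ac≤b2ᴺ b≤qc =
    Qₚ.*-cancelʳ-≤-pos (ι (c ℕ.* 2 ^ N)) {{ι-pos (c ℕ.* 2 ^ N) {{ℕₚ.m*n≢0 c (2 ^ N)}}}} (begin
      ι a * ½ ^ℚ N * ι (c ℕ.* 2 ^ N)     ≡⟨ cong (ι a * ½ ^ℚ N *_) (ι-* c (2 ^ N)) ⟩
      ι a * ½ ^ℚ N * (ι c * ι (2 ^ N))   ≡⟨ interchange (ι a) (½ ^ℚ N) (ι c) (ι (2 ^ N)) ⟩
      ι a * ι c * (½ ^ℚ N * ι (2 ^ N))   ≡⟨ cong₂ _*_ (sym (ι-* a c)) (½^n*2^n≡1 N) ⟩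
      ι (a ℕ.* c) * 1ℚ                   ≡⟨ Qₚ.*-identityʳ _ ⟩
      ι (a ℕ.* c)                        ≤⟨ ι-mono-≤ ac≤b2ᴺ ⟩
      ι (b ℕ.* 2 ^ N)                    ≡⟨ ι-* b (2 ^ N) ⟩
      ι b * ι (2 ^ N)                    ≤⟨ Qₚ.*-monoʳ-≤-nonNeg (ι (2 ^ N)) {{ι-nonNeg (2 ^ N)}} b≤qc ⟩
      q * ι c * ι (2 ^ N)                ≡⟨ Qₚ.*-assoc q (ι c) (ι (2 ^ N)) ⟩
      q * (ι c * ι (2 ^ N))              ≡⟨ cong (q *_) (ι-* c (2 ^ N)) ⟨
      q * ι (c ℕ.* 2 ^ N)                ∎)
    where
    open Qₚ.≤-Reasoning
    instance
      2^N≢0 : NonZero (2 ^ N)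
      2^N≢0 = ℕₚ.m^n≢0 2 N
    interchange : ∀ w x y z → w * x * (y * z) ≡ w * y * (x * z)
    interchange = solve 4 (λ w x y z → w :* x :* (y :* z) := w :* y :* (x :* z)) refl

  ∣p-q∣≤r : ∀ {p q r} → p ≤ q + r → q ≤ p + r → ∣ p - q ∣ ≤ r
  ∣p-q∣≤r {p} {q} {r} p≤q+r q≤p+r with Qₚ.∣p∣≡p∨∣p∣≡-p (p - q)
  ... | inj₁ ∣p-q∣≡p-q = subst (_≤ r) (sym ∣p-q∣≡p-q)
    (subst₂ _≤_ (sub-eq p q) (cancel q r) (Qₚ.+-monoˡ-≤ (- q) p≤q+r))
    where
    sub-eq : ∀ p q → p + - q ≡ p - q
    sub-eq = solve 2 (λ p q → p :+ (:- q) := p :- q) refl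
    cancel : ∀ q r → q + r + - q ≡ r
    cancel = solve 2 (λ q r → q :+ r :+ (:- q) := r) refl
  ... | inj₂ ∣p-q∣≡q-p = subst (_≤ r) (sym ∣p-q∣≡q-p)
    (subst₂ _≤_ (sub-eq p q) (cancel p r) (Qₚ.+-monoˡ-≤ (- p) q≤p+r))
    where
    sub-eq : ∀ p q → q + - p ≡ - (p - q)
    sub-eq = solve 2 (λ p q → q :+ (:- p) := :- (p :- q)) refl
    cancel : ∀ p r → p + r + - p ≡ r
    cancel = solve 2 (λ p r → p :+ r :+ (:- p) := r) refl

  -- The denominator of ε works.
  archimedean : ∀ ε → 0ℚ < ε → ∃[ D ] NonZero D × ι 1 ≤ ε * ι D
  archimedean ε@(mkℚ +[1+ n ] d-1 _) _ = suc d-1 , _ , Qₚ.toℚᵘ-cancel-≤ (begin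
    toℚᵘ (ι 1)                                      ≃⟨ ι≃ 1 ⟩
    Qᵘ.mkℚᵘ (+ 1) 0                                 ≤⟨ Qᵘ.*≤* (ℤ.+≤+ D≤[1+n]*D) ⟩
    Qᵘ.mkℚᵘ +[1+ n ] d-1 Qᵘ.* Qᵘ.mkℚᵘ (+ suc d-1) 0  ≃⟨ Qᵘₚ.*-congˡ {Qᵘ.mkℚᵘ +[1+ n ] d-1} (ι≃ (suc d-1)) ⟨
    toℚᵘ ε Qᵘ.* toℚᵘ (ι (suc d-1))                  ≃⟨ Qₚ.toℚᵘ-homo-* ε (ι (suc d-1)) ⟨
    toℚᵘ (ε * ι (suc d-1))                          ∎)
    where
    open Qᵘₚ.≤-Reasoning
    D≤[1+n]*D : 1 ℕ.* (suc d-1 ℕ.* 1) ℕ.≤ suc n ℕ.* suc d-1 ℕ.* 1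
    D≤[1+n]*D = ℕₚ.≤-trans (ℕₚ.≤-reflexive (ℕₚ.*-identityˡ _)) (ℕₚ.*-monoˡ-≤ 1 (ℕₚ.m≤n*m (suc d-1) (suc n)))
  archimedean (mkℚ (+ zero)   _ _) (Q.*<* (ℤ.+<+ ()))
  archimedean (mkℚ -[1+ _ ]   _ _) (Q.*<* ())

  ½^[a+r]*2^r≡½^a : ∀ a r → ½ ^ℚ (a ℕ.+ r) * ι (2 ^ r) ≡ ½ ^ℚ a
  ½^[a+r]*2^r≡½^a a r = begin
    ½ ^ℚ (a ℕ.+ r) * ι (2 ^ r)        ≡⟨ cong (_* ι (2 ^ r)) (^ℚ-distribˡ-+-* ½ a r) ⟩
    ½ ^ℚ a * ½ ^ℚ r * ι (2 ^ r)       ≡⟨ Qₚ.*-assoc (½ ^ℚ a) _ _ ⟩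
    ½ ^ℚ a * (½ ^ℚ r * ι (2 ^ r))     ≡⟨ cong (½ ^ℚ a *_) (½^n*2^n≡1 r) ⟩
    ½ ^ℚ a * 1ℚ                       ≡⟨ Qₚ.*-identityʳ _ ⟩
    ½ ^ℚ a                            ∎
    where open ≡-Reasoning

  ∣prob-prob∣≤ : ∀ {X Y B} a r → X ℕ.≤ 2 ^ r ℕ.* Y ℕ.+ B → 2 ^ r ℕ.* Y ℕ.≤ X ℕ.+ B →
    ∣ ι X * ½ ^ℚ (a ℕ.+ r) - ι Y * ½ ^ℚ a ∣ ≤ ι B * ½ ^ℚ (a ℕ.+ r)
  ∣prob-prob∣≤ {X} {Y} {B} a r X≤ Z≤ = begin
    ∣ ι X * h - ι Y * ½ ^ℚ a ∣          ≡⟨ cong (λ t → ∣ ι X * h - ι Y * t ∣) (½^[a+r]*2^r≡½^a a r) ⟨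
    ∣ ι X * h - ι Y * (h * ι (2 ^ r)) ∣ ≡⟨ cong ∣_∣ (factor (ι X) (ι Y) h (ι (2 ^ r))) ⟩
    ∣ (ι X - ι (2 ^ r) * ι Y) * h ∣     ≡⟨ cong (λ t → ∣ (ι X - t) * h ∣) (ι-* (2 ^ r) Y) ⟨
    ∣ (ι X - ι Z) * h ∣                 ≡⟨ Qₚ.∣p*q∣≡∣p∣*∣q∣ (ι X - ι Z) h ⟩
    ∣ ι X - ι Z ∣ * ∣ h ∣               ≡⟨ cong (∣ ι X - ι Z ∣ *_) (Qₚ.0≤p⇒∣p∣≡p 0≤h) ⟩
    ∣ ι X - ι Z ∣ * h                   ≤⟨ Qₚ.*-monoʳ-≤-nonNeg h {{h-nonNeg}} ∣X-Z∣≤B ⟩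
    ι B * h                             ∎
    where
    open Qₚ.≤-Reasoning
    h = ½ ^ℚ (a ℕ.+ r)
    Z = 2 ^ r ℕ.* Y
    factor : ∀ x y h t → x * h - y * (h * t) ≡ (x - t * y) * h
    factor = solve 4 (λ x y h t → x :* h :- y :* (h :* t) := (x :- t :* y) :* h) refl
    ½^n-pos : ∀ n → Positive (½ ^ℚ n)
    ½^n-pos zero    = _
    ½^n-pos (suc n) = Qₚ.pos*pos⇒pos ½ (½ ^ℚ n) {{½^n-pos n}}
    h-nonNeg : NonNegative h
    h-nonNeg = Qₚ.pos⇒nonNeg h {{½^n-pos (a ℕ.+ r)}}
    0≤h : 0ℚ ≤ h
    0≤h = Qₚ.nonNegative⁻¹ h {{h-nonNeg}}
    ∣X-Z∣≤B : ∣ ι X - ι Z ∣ ≤ ι B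
    ∣X-Z∣≤B = ∣p-q∣≤r (Qₚ.≤-trans (ι-mono-≤ X≤) (Qₚ.≤-reflexive (ι-+ Z B)))
                      (Qₚ.≤-trans (ι-mono-≤ Z≤) (Qₚ.≤-reflexive (ι-+ X B)))

  ι[3^[1+n]]≡ι4*¾^[n+1]*ι[4^n] : ∀ n → ι (3 ^ suc n) ≡ ι 4 * ¾ ^ℚ (n ℕ.+ 1) * ι (4 ^ n)
  ι[3^[1+n]]≡ι4*¾^[n+1]*ι[4^n] n = begin
    ι (3 ^ suc n)                          ≡⟨ ¾^n*4^n≡3^n (suc n) ⟨
    ¾ ^ℚ suc n * ι (4 ^ suc n)             ≡⟨ cong (¾ ^ℚ suc n *_) (ι-* 4 (4 ^ n)) ⟩
    ¾ ^ℚ suc n * (ι 4 * ι (4 ^ n))         ≡⟨ regroup (¾ ^ℚ suc n) (ι 4) (ι (4 ^ n)) ⟩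
    ι 4 * ¾ ^ℚ suc n * ι (4 ^ n)           ≡⟨ cong (λ e → ι 4 * ¾ ^ℚ e * ι (4 ^ n)) (ℕₚ.+-comm 1 n) ⟩
    ι 4 * ¾ ^ℚ (n ℕ.+ 1) * ι (4 ^ n)       ∎
    where
    open ≡-Reasoning
    regroup : ∀ x y z → x * (y * z) ≡ y * x * z
    regroup = solve 3 (λ x y z → x :* (y :* z) := y :* x :* z) refl

open RationalBounds
open import Data.Nat as ℕ
  using (ℕ; zero; suc; _+_; _*_; _∸_; _^_; _≤_; _<_; _≟_; _≤?_; z≤n; s≤s; z<s; s<s; NonZero)
open import Data.Nat.Properties
open import Data.Nat.DivMod using (m≡m%n+[m/n]*n; m%n<n; m≥n⇒m/n>0)
open import Data.Nat.Tactic.RingSolver using (solve-∀)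
open import Algebra.Properties.CommutativeSemigroup +-commutativeSemigroup using (interchange; x∙yz≈y∙xz)
import Data.Integer as ℤ
import Data.Integer.Properties as ℤₚ
open import Data.Integer.Tactic.RingSolver using () renaming (solve-∀ to ℤ-solve-∀)
open import Data.List using (List; []; _∷_; map; filter; length; upTo; applyUpTo)
  renaming (_++_ to _++ₗ_)
open import Data.Rational using (ℚ; _/_; ∣_∣; _-_; 0ℚ)
import Data.Rational as Q
import Data.Rational.Properties as Qₚ

𝟙 : Bool → ℕ
𝟙 true  = 1
𝟙 false = 0

𝟙≤1 : ∀ b → 𝟙 b ≤ 1
𝟙≤1 true  = ≤-refl
𝟙≤1 false = z≤n

≡-from-⇔ : ∀ {a b : Bool} → (a ≡ true → b ≡ true) → (b ≡ true → a ≡ true) → a ≡ b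
≡-from-⇔ {true}  {true}  _ _ = refl
≡-from-⇔ {true}  {false} a⇒b _ = sym (a⇒b refl)
≡-from-⇔ {false} {true}  _ b⇒a = b⇒a refl
≡-from-⇔ {false} {false} _ _ = refl

sumSubsets : (n : ℕ) → (Subset n → ℕ) → ℕ
sumSubsets zero    F = F []
sumSubsets (suc n) F = sumSubsets n (λ S → F (true ∷ S)) + sumSubsets n (λ S → F (false ∷ S))

count : (n : ℕ) → (Subset n → Bool) → ℕ
count n p = sumSubsets n (λ S → 𝟙 (p S))

sumSubsets-cong : ∀ n {F G : Subset n → ℕ} → (∀ S → F S ≡ G S) → sumSubsets n F ≡ sumSubsets n G
sumSubsets-cong zero    F≗G = F≗G []
sumSubsets-cong (suc n) F≗G =
  cong₂ _+_ (sumSubsets-cong n (λ S → F≗G (true ∷ S))) (sumSubsets-cong n (λ S → F≗G (false ∷ S)))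

sumSubsets-mono-≤ : ∀ n {F G : Subset n → ℕ} → (∀ S → F S ≤ G S) → sumSubsets n F ≤ sumSubsets n G
sumSubsets-mono-≤ zero    F≤G = F≤G []
sumSubsets-mono-≤ (suc n) F≤G =
  +-mono-≤ (sumSubsets-mono-≤ n (λ S → F≤G (true ∷ S))) (sumSubsets-mono-≤ n (λ S → F≤G (false ∷ S)))

sumSubsets-distrib-+ : ∀ n (F G : Subset n → ℕ) →
  sumSubsets n (λ S → F S + G S) ≡ sumSubsets n F + sumSubsets n G
sumSubsets-distrib-+ zero    F G = refl
sumSubsets-distrib-+ (suc n) F G = trans
  (cong₂ _+_ (sumSubsets-distrib-+ n (λ S → F (true ∷ S)) (λ S → G (true ∷ S)))
             (sumSubsets-distrib-+ n (λ S → F (false ∷ S)) (λ S → G (false ∷ S))))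
  (interchange (sumSubsets n (λ S → F (true ∷ S))) (sumSubsets n (λ S → G (true ∷ S)))
               (sumSubsets n (λ S → F (false ∷ S))) (sumSubsets n (λ S → G (false ∷ S))))

sumSubsets-*ˡ : ∀ n c (F : Subset n → ℕ) → sumSubsets n (λ S → c * F S) ≡ c * sumSubsets n F
sumSubsets-*ˡ zero    c F = refl
sumSubsets-*ˡ (suc n) c F = trans
  (cong₂ _+_ (sumSubsets-*ˡ n c (λ S → F (true ∷ S))) (sumSubsets-*ˡ n c (λ S → F (false ∷ S))))
  (sym (*-distribˡ-+ c _ _))

sumSubsets-*ʳ : ∀ n c (F : Subset n → ℕ) → sumSubsets n (λ S → F S * c) ≡ sumSubsets n F * c
sumSubsets-*ʳ n c F = trans (sumSubsets-cong n (λ S → *-comm (F S) c))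
                            (trans (sumSubsets-*ˡ n c F) (*-comm c _))

sumSubsets-const : ∀ n c → sumSubsets n (λ _ → c) ≡ 2 ^ n * c
sumSubsets-const zero    c = sym (+-identityʳ c)
sumSubsets-const (suc n) c = trans (cong₂ _+_ (sumSubsets-const n c) (sumSubsets-const n c)) (double (2 ^ n) c)
  where
  double : ∀ x c → x * c + x * c ≡ (2 * x) * c
  double = solve-∀

sumSubsets-++ : ∀ a b (F : Subset (a + b) → ℕ) →
  sumSubsets (a + b) F ≡ sumSubsets a (λ u → sumSubsets b (λ v → F (u ++ v)))
sumSubsets-++ zero    b F = refl
sumSubsets-++ (suc a) b F = cong₂ _+_ (sumSubsets-++ a b (λ S → F (true ∷ S))) (sumSubsets-++ a b (λ S → F (false ∷ S)))

count≤count+exceptions : ∀ n (p q good : Subset n → Bool) → (∀ S → good S ≡ true → p S ≡ q S) →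
  count n p ≤ count n q + count n (λ S → not (good S))
count≤count+exceptions n p q good agree =
  ≤-trans (sumSubsets-mono-≤ n pointwise) (≤-reflexive (sumSubsets-distrib-+ n _ _))
  where
  pointwise : ∀ S → 𝟙 (p S) ≤ 𝟙 (q S) + 𝟙 (not (good S))
  pointwise S with good S in good≡
  ... | true  rewrite agree S good≡ = ≤-reflexive (sym (+-identityʳ _))
  ... | false = ≤-trans (𝟙≤1 (p S)) (m≤n+m 1 (𝟙 (q S)))

sumBelow : ℕ → (ℕ → ℕ) → ℕ
sumBelow zero    F = 0
sumBelow (suc n) F = F 0 + sumBelow n (λ i → F (suc i))

countBelow : ℕ → (ℕ → Bool) → ℕ
countBelow n p = sumBelow n (λ i → 𝟙 (p i))

sumBelow-cong : ∀ n {F G : ℕ → ℕ} → (∀ i → i < n → F i ≡ G i) → sumBelow n F ≡ sumBelow n G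
sumBelow-cong zero    F≗G = refl
sumBelow-cong (suc n) F≗G = cong₂ _+_ (F≗G 0 z<s) (sumBelow-cong n (λ i i<n → F≗G (suc i) (s<s i<n)))

countBelow-cong : ∀ n {p q : ℕ → Bool} → (∀ i → i < n → p i ≡ q i) → countBelow n p ≡ countBelow n q
countBelow-cong n p≗q = sumBelow-cong n (λ i i<n → cong 𝟙 (p≗q i i<n))

sumBelow-mono-≤ : ∀ n {F G : ℕ → ℕ} → (∀ i → i < n → F i ≤ G i) → sumBelow n F ≤ sumBelow n G
sumBelow-mono-≤ zero    F≤G = z≤n
sumBelow-mono-≤ (suc n) F≤G = +-mono-≤ (F≤G 0 z<s) (sumBelow-mono-≤ n (λ i i<n → F≤G (suc i) (s<s i<n)))

sumBelow-≤-* : ∀ n c {F : ℕ → ℕ} → (∀ i → i < n → F i ≤ c) → sumBelow n F ≤ n * c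
sumBelow-≤-* zero    c F≤c = z≤n
sumBelow-≤-* (suc n) c F≤c = +-mono-≤ (F≤c 0 z<s) (sumBelow-≤-* n c (λ i i<n → F≤c (suc i) (s<s i<n)))

sumBelow-distrib-+ : ∀ n (F G : ℕ → ℕ) → sumBelow n (λ i → F i + G i) ≡ sumBelow n F + sumBelow n G
sumBelow-distrib-+ zero    F G = refl
sumBelow-distrib-+ (suc n) F G =
  trans (cong ((F 0 + G 0) +_) (sumBelow-distrib-+ n _ _))
        (interchange (F 0) (G 0) (sumBelow n (λ i → F (suc i))) (sumBelow n (λ i → G (suc i))))

sumBelow-*ˡ : ∀ n c (F : ℕ → ℕ) → sumBelow n (λ i → c * F i) ≡ c * sumBelow n F
sumBelow-*ˡ zero    c F = sym (*-zeroʳ c)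
sumBelow-*ˡ (suc n) c F =
  trans (cong (c * F 0 +_) (sumBelow-*ˡ n c (λ i → F (suc i)))) (sym (*-distribˡ-+ c (F 0) _))

sumBelow-*ʳ : ∀ n c (F : ℕ → ℕ) → sumBelow n (λ i → F i * c) ≡ sumBelow n F * c
sumBelow-*ʳ n c F = trans (sumBelow-cong n (λ i _ → *-comm (F i) c)) (trans (sumBelow-*ˡ n c F) (*-comm c _))

sumBelow-+ : ∀ a b (F : ℕ → ℕ) → sumBelow (a + b) F ≡ sumBelow a F + sumBelow b (λ i → F (a + i))
sumBelow-+ zero    b F = refl
sumBelow-+ (suc a) b F = trans (cong (F 0 +_) (sumBelow-+ a b (λ i → F (suc i)))) (sym (+-assoc (F 0) _ _))

sumBelow-last : ∀ n (F : ℕ → ℕ) → sumBelow (suc n) F ≡ sumBelow n F + F n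
sumBelow-last zero    F = +-comm (F 0) 0
sumBelow-last (suc n) F = trans (cong (F 0 +_) (sumBelow-last n (λ i → F (suc i)))) (sym (+-assoc (F 0) _ _))

sumBelow-reverse : ∀ n (F : ℕ → ℕ) → sumBelow n (λ i → F (n ∸ i)) ≡ sumBelow n (λ i → F (suc i))
sumBelow-reverse zero    F = refl
sumBelow-reverse (suc n) F = begin
  F (suc n) + sumBelow n (λ i → F (n ∸ i))      ≡⟨ cong (F (suc n) +_) (sumBelow-reverse n F) ⟩
  F (suc n) + sumBelow n (λ i → F (suc i))      ≡⟨ +-comm (F (suc n)) _ ⟩
  sumBelow n (λ i → F (suc i)) + F (suc n)      ≡⟨ sumBelow-last n (λ i → F (suc i)) ⟨
  sumBelow (suc n) (λ i → F (suc i))            ∎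
  where open ≡-Reasoning

sumSubsets-sumBelow : ∀ n L (F : Subset n → ℕ → ℕ) →
  sumSubsets n (λ S → sumBelow L (F S)) ≡ sumBelow L (λ d → sumSubsets n (λ S → F S d))
sumSubsets-sumBelow n zero    F = trans (sumSubsets-const n 0) (*-zeroʳ (2 ^ n))
sumSubsets-sumBelow n (suc L) F = trans (sumSubsets-distrib-+ n (λ S → F S 0) (λ S → sumBelow L (λ i → F S (suc i))))
  (cong (sumSubsets n (λ S → F S 0) +_) (sumSubsets-sumBelow n L (λ S i → F S (suc i))))

-- Differences

member : ∀ {n} → Subset n → ℕ → Bool
member []      x       = false
member (b ∷ S) zero    = b
member (b ∷ S) (suc x) = member S x

anyBelow : ℕ → (ℕ → Bool) → Bool
anyBelow zero    p = false
anyBelow (suc n) p = p 0 ∨ anyBelow n (λ i → p (suc i))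

allBelow : ℕ → (ℕ → Bool) → Bool
allBelow zero    p = true
allBelow (suc n) p = p 0 ∧ allBelow n (λ i → p (suc i))

hasDiff : ∀ {n} → Subset n → ℕ → Bool
hasDiff {n} S d = anyBelow n (λ x → member S x ∧ member S (x + d))

member⇒< : ∀ {n} (S : Subset n) x → member S x ≡ true → x < n
member⇒< (b ∷ S) zero    _ = z<s
member⇒< (b ∷ S) (suc x) e = s<s (member⇒< S x e)

member-++ʳ : ∀ {a b} (u : Subset a) (v : Subset b) y → member (u ++ v) (a + y) ≡ member v y
member-++ʳ []      v y = refl
member-++ʳ (b ∷ u) v y = member-++ʳ u v y

member-++ˡ : ∀ {a b} (u : Subset a) (v : Subset b) x → x < a → member (u ++ v) x ≡ member u x
member-++ˡ (b ∷ u) v zero    _         = refl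
member-++ˡ (b ∷ u) v (suc x) (s<s x<a) = member-++ˡ u v x x<a

anyBelow⁺ : ∀ n (p : ℕ → Bool) x → x < n → p x ≡ true → anyBelow n p ≡ true
anyBelow⁺ (suc n) p zero    _         px rewrite px = refl
anyBelow⁺ (suc n) p (suc x) (s<s x<n) px with p 0
... | true  = refl
... | false = anyBelow⁺ n (λ i → p (suc i)) x x<n px

anyBelow⁻ : ∀ n (p : ℕ → Bool) → anyBelow n p ≡ true → ∃[ x ] x < n × p x ≡ true
anyBelow⁻ (suc n) p any with p 0 in p0
... | true  = 0 , z<s , p0
... | false with anyBelow⁻ n (λ i → p (suc i)) any
...   | x , x<n , px = suc x , s<s x<n , px

allBelow⁻ : ∀ n (p : ℕ → Bool) → allBelow n p ≡ true → ∀ x → x < n → p x ≡ true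
allBelow⁻ (suc n) p all zero    _         = ∧-conicalˡ (p 0) _ all
allBelow⁻ (suc n) p all (suc x) (s<s x<n) = allBelow⁻ n (λ i → p (suc i)) (∧-conicalʳ (p 0) _ all) x x<n

allBelow⇒countBelow≡ : ∀ n (p : ℕ → Bool) → allBelow n p ≡ true → countBelow n p ≡ n
allBelow⇒countBelow≡ zero    p all = refl
allBelow⇒countBelow≡ (suc n) p all rewrite ∧-conicalˡ (p 0) _ all =
  cong suc (allBelow⇒countBelow≡ n (λ i → p (suc i)) (∧-conicalʳ (p 0) _ all))

union-bound : ∀ n (p : ℕ → Bool) → 𝟙 (not (allBelow n p)) ≤ sumBelow n (λ i → 𝟙 (not (p i)))
union-bound zero    p = z≤n
union-bound (suc n) p with p 0
... | true  = union-bound n (λ i → p (suc i))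
... | false = s≤s z≤n

hasDiff⁺ : ∀ {n} (S : Subset n) d x → member S x ≡ true → member S (x + d) ≡ true → hasDiff S d ≡ true
hasDiff⁺ S d x x∈S x+d∈S = anyBelow⁺ _ _ x (member⇒< S x x∈S) (cong₂ _∧_ x∈S x+d∈S)

hasDiff⁻ : ∀ {n} (S : Subset n) d → hasDiff S d ≡ true → ∃[ x ] member S x ≡ true × member S (x + d) ≡ true
hasDiff⁻ {n} S d diff with anyBelow⁻ n (λ x → member S x ∧ member S (x + d)) diff
... | x , _ , both = x , ∧-conicalˡ (member S x) _ both , ∧-conicalʳ (member S x) _ both

hasDiff-size : ∀ {n} (S : Subset n) → hasDiff S n ≡ false
hasDiff-size {n} S with hasDiff S n in diff
... | false = refl
... | true with hasDiff⁻ S n diff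
...   | x , _ , x+n∈S = ⊥-elim (<-irrefl refl (≤-trans (s≤s (m≤n+m n x)) (member⇒< S (x + n) x+n∈S)))

hasDiff⇒hasDiff-0 : ∀ {n} (S : Subset n) d → hasDiff S d ≡ true → hasDiff S 0 ≡ true
hasDiff⇒hasDiff-0 S d diff with hasDiff⁻ S d diff
... | x , x∈S , _ = hasDiff⁺ S 0 x x∈S (trans (cong (member S) (+-identityʳ x)) x∈S)

-- Sets avoiding a difference

avoiding : ℕ → ℕ → ℕ
avoiding n d = count n (λ S → not (hasDiff S d))

avoiding-≤ : ∀ n d → avoiding n d ≤ 2 ^ n
avoiding-≤ n d = ≤-trans (sumSubsets-mono-≤ n (λ S → 𝟙≤1 (not (hasDiff S d))))
                         (≤-reflexive (trans (sumSubsets-const n 1) (*-identityʳ (2 ^ n))))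

avoiding-0≤avoiding-1 : ∀ n → avoiding n 0 ≤ avoiding n 1
avoiding-0≤avoiding-1 n = sumSubsets-mono-≤ n pointwise
  where
  pointwise : ∀ S → 𝟙 (not (hasDiff S 0)) ≤ 𝟙 (not (hasDiff S 1))
  pointwise S with hasDiff S 1 in diff₁
  ... | false = 𝟙≤1 (not (hasDiff S 0))
  ... | true rewrite hasDiff⇒hasDiff-0 S 1 diff₁ = z≤n

disjointᵇ : ∀ {t} → Subset t → Subset t → Bool
disjointᵇ []      []      = true
disjointᵇ (a ∷ u) (b ∷ v) = not (a ∧ b) ∧ disjointᵇ u v

count-disjoint-pairs : ∀ t → sumSubsets t (λ u → sumSubsets t (λ v → 𝟙 (disjointᵇ u v))) ≡ 3 ^ t
count-disjoint-pairs zero    = refl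
count-disjoint-pairs (suc t) = begin
  sumSubsets t (λ u → sumSubsets t (λ _ → 0) + D u) + sumSubsets t (λ u → D u + D u)
    ≡⟨ cong₂ _+_ (sumSubsets-cong t (λ u → cong (_+ D u) (trans (sumSubsets-const t 0) (*-zeroʳ (2 ^ t)))))
                 (sumSubsets-distrib-+ t D D) ⟩
  sumSubsets t D + (sumSubsets t D + sumSubsets t D)
    ≡⟨ cong (λ x → x + (x + x)) (count-disjoint-pairs t) ⟩
  3 ^ t + (3 ^ t + 3 ^ t)
    ≡⟨ triple (3 ^ t) ⟩
  3 ^ suc t ∎
  where
  open ≡-Reasoning
  D : Subset t → ℕ
  D u = sumSubsets t (λ v → 𝟙 (disjointᵇ u v))
  triple : ∀ x → x + (x + x) ≡ 3 * x
  triple = solve-∀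

¬disjoint⇒common : ∀ {t} (u v : Subset t) → disjointᵇ u v ≡ false → ∃[ i ] member u i ≡ true × member v i ≡ true
¬disjoint⇒common []          []          ()
¬disjoint⇒common (true  ∷ u) (true  ∷ v) _ = 0 , refl , refl
¬disjoint⇒common (true  ∷ u) (false ∷ v) ¬disj with ¬disjoint⇒common u v ¬disj
... | i , i∈u , i∈v = suc i , i∈u , i∈v
¬disjoint⇒common (false ∷ u) (b ∷ v) ¬disj with ¬disjoint⇒common u v ¬disj
... | i , i∈u , i∈v = suc i , i∈u , i∈v

-- The window u ++ w ++ v of length 2t + e, with d = t + e, contains the t disjoint pairs {i, i + d}.
module Window {t e n} (u : Subset t) (w : Subset e) (v : Subset t) (z : Subset n) where

  S : Subset (t + (e + (t + n)))
  S = u ++ (w ++ (v ++ z))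

  hasDiff-from-window : disjointᵇ u v ≡ false → hasDiff S (t + e) ≡ true
  hasDiff-from-window ¬disj with ¬disjoint⇒common u v ¬disj
  ... | i , i∈u , i∈v = hasDiff⁺ S (t + e) i
    (trans (member-++ˡ u _ i (member⇒< u i i∈u)) i∈u)
    (begin
      member S (i + (t + e))   ≡⟨ cong (member S) (shift t e i) ⟩
      member S (t + (e + i))   ≡⟨ member-++ʳ u _ _ ⟩
      member (w ++ (v ++ z)) (e + i) ≡⟨ member-++ʳ w _ _ ⟩
      member (v ++ z) i        ≡⟨ member-++ˡ v z i (member⇒< v i i∈v) ⟩
      member v i               ≡⟨ i∈v ⟩
      true                     ∎)
    where
    open ≡-Reasoning
    shift : ∀ t e i → i + (t + e) ≡ t + (e + i)
    shift = solve-∀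

  hasDiff-from-tail : hasDiff z (t + e) ≡ true → hasDiff S (t + e) ≡ true
  hasDiff-from-tail diff with hasDiff⁻ z (t + e) diff
  ... | x , x∈z , x+d∈z = hasDiff⁺ S (t + e) (t + (e + (t + x)))
    (trans (member-++ʳ u _ _) (trans (member-++ʳ w _ _) (trans (member-++ʳ v z x) x∈z)))
    (trans (cong (member S) (shift t e x))
      (trans (member-++ʳ u _ _) (trans (member-++ʳ w _ _) (trans (member-++ʳ v z (x + (t + e))) x+d∈z))))
    where
    shift : ∀ t e x → t + (e + (t + x)) + (t + e) ≡ t + (e + (t + (x + (t + e))))
    shift = solve-∀

  avoiding-pointwise : 𝟙 (not (hasDiff S (t + e))) ≤ 𝟙 (disjointᵇ u v) * 𝟙 (not (hasDiff z (t + e)))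
  avoiding-pointwise with disjointᵇ u v in disj | hasDiff z (t + e) in diff
  ... | true  | false = 𝟙≤1 _
  ... | true  | true  rewrite hasDiff-from-tail diff = z≤n
  ... | false | _     rewrite hasDiff-from-window disj = z≤n

avoiding-window : ∀ t e n → avoiding (t + (e + (t + n))) (t + e) ≤ 3 ^ t * 2 ^ e * avoiding n (t + e)
avoiding-window t e n = begin
  avoiding (t + (e + (t + n))) d
    ≡⟨ sumSubsets-++ t _ _ ⟩
  sumSubsets t (λ u → sumSubsets (e + (t + n)) (λ r → F (u ++ r)))
    ≡⟨ sumSubsets-cong t (λ u → sumSubsets-++ e _ _) ⟩
  sumSubsets t (λ u → sumSubsets e (λ w → sumSubsets (t + n) (λ r → F (u ++ (w ++ r)))))
    ≡⟨ sumSubsets-cong t (λ u → sumSubsets-cong e (λ w → sumSubsets-++ t _ _)) ⟩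
  sumSubsets t (λ u → sumSubsets e (λ w → sumSubsets t (λ v → sumSubsets n (λ z → F (u ++ (w ++ (v ++ z)))))))
    ≤⟨ sumSubsets-mono-≤ t (λ u → sumSubsets-mono-≤ e (λ w → sumSubsets-mono-≤ t (λ v →
         sumSubsets-mono-≤ n (λ z → Window.avoiding-pointwise u w v z)))) ⟩
  sumSubsets t (λ u → sumSubsets e (λ w → sumSubsets t (λ v → sumSubsets n (λ z → 𝟙 (disjointᵇ u v) * G z))))
    ≡⟨ sumSubsets-cong t (λ u → sumSubsets-cong e (λ w → sumSubsets-cong t (λ v → sumSubsets-*ˡ n (𝟙 (disjointᵇ u v)) G))) ⟩
  sumSubsets t (λ u → sumSubsets e (λ w → sumSubsets t (λ v → 𝟙 (disjointᵇ u v) * avoiding n d)))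
    ≡⟨ sumSubsets-cong t (λ u → sumSubsets-cong e (λ w → sumSubsets-*ʳ t _ _)) ⟩
  sumSubsets t (λ u → sumSubsets e (λ w → sumSubsets t (λ v → 𝟙 (disjointᵇ u v)) * avoiding n d))
    ≡⟨ sumSubsets-cong t (λ u → sumSubsets-const e _) ⟩
  sumSubsets t (λ u → 2 ^ e * (sumSubsets t (λ v → 𝟙 (disjointᵇ u v)) * avoiding n d))
    ≡⟨ sumSubsets-*ˡ t (2 ^ e) _ ⟩
  2 ^ e * sumSubsets t (λ u → sumSubsets t (λ v → 𝟙 (disjointᵇ u v)) * avoiding n d)
    ≡⟨ cong (2 ^ e *_) (sumSubsets-*ʳ t _ _) ⟩
  2 ^ e * (sumSubsets t (λ u → sumSubsets t (λ v → 𝟙 (disjointᵇ u v))) * avoiding n d)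
    ≡⟨ cong (λ x → 2 ^ e * (x * avoiding n d)) (count-disjoint-pairs t) ⟩
  2 ^ e * (3 ^ t * avoiding n d)
    ≡⟨ reorder (2 ^ e) (3 ^ t) (avoiding n d) ⟩
  3 ^ t * 2 ^ e * avoiding n d ∎
  where
  open ≤-Reasoning
  d = t + e
  F : Subset (t + (e + (t + n))) → ℕ
  F S = 𝟙 (not (hasDiff S d))
  G : Subset n → ℕ
  G z = 𝟙 (not (hasDiff z d))
  reorder : ∀ a b c → a * (b * c) ≡ b * a * c
  reorder = solve-∀

avoiding-periodic : ∀ d q s → avoiding (q * (d + d) + s) d ≤ 3 ^ (q * d) * 2 ^ s
avoiding-periodic d zero    s = ≤-trans (avoiding-≤ s d) (≤-reflexive (sym (+-identityʳ (2 ^ s))))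
avoiding-periodic d (suc q) s = begin
  avoiding (suc q * (d + d) + s) d          ≡⟨ cong (λ n → avoiding n d) (unfold d (q * (d + d)) s) ⟩
  avoiding (d + (d + (q * (d + d) + s))) d  ≤⟨ one-window ⟩
  3 ^ d * avoiding (q * (d + d) + s) d      ≤⟨ *-monoʳ-≤ (3 ^ d) (avoiding-periodic d q s) ⟩
  3 ^ d * (3 ^ (q * d) * 2 ^ s)             ≡⟨ *-assoc (3 ^ d) _ _ ⟨
  3 ^ d * 3 ^ (q * d) * 2 ^ s               ≡⟨ cong (_* 2 ^ s) (^-distribˡ-+-* 3 d (q * d)) ⟨
  3 ^ (suc q * d) * 2 ^ s                   ∎
  where
  open ≤-Reasoning
  unfold : ∀ d x s → d + d + x + s ≡ d + (d + (x + s))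
  unfold = solve-∀
  one-window : avoiding (d + (d + (q * (d + d) + s))) d ≤ 3 ^ d * avoiding (q * (d + d) + s) d
  one-window = subst (λ d′ → avoiding (d + (d + (q * (d + d) + s))) d′ ≤ 3 ^ d * avoiding (q * (d + d) + s) d′)
    (+-identityʳ d)
    (≤-trans (avoiding-window d 0 _) (≤-reflexive (cong (_* avoiding (q * (d + d) + s) (d + 0)) (*-identityʳ (3 ^ d)))))

4^n≡2^n*2^n : ∀ n → 4 ^ n ≡ 2 ^ n * 2 ^ n
4^n≡2^n*2^n zero    = refl
4^n≡2^n*2^n (suc n) = trans (cong (4 *_) (4^n≡2^n*2^n n)) (square (2 ^ n))
  where
  square : ∀ x → 4 * (x * x) ≡ (2 * x) * (2 * x)
  square = solve-∀

[3/4]^-antitone : ∀ G n {T D} → T ≤ D → G * 4 ^ D ≤ 3 ^ D * 2 ^ n → G * 4 ^ T ≤ 3 ^ T * 2 ^ n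
[3/4]^-antitone G n {T} T≤D bound with m≤n⇒∃[o]m+o≡n T≤D
... | u , refl = *-cancelʳ-≤ (G * 4 ^ T) (3 ^ T * 2 ^ n) (4 ^ u) {{m^n≢0 4 u}} (begin
  G * 4 ^ T * 4 ^ u        ≡⟨ *-assoc G _ _ ⟩
  G * (4 ^ T * 4 ^ u)      ≡⟨ cong (G *_) (^-distribˡ-+-* 4 T u) ⟨
  G * 4 ^ (T + u)          ≤⟨ bound ⟩
  3 ^ (T + u) * 2 ^ n      ≡⟨ cong (_* 2 ^ n) (^-distribˡ-+-* 3 T u) ⟩
  3 ^ T * 3 ^ u * 2 ^ n    ≤⟨ *-monoˡ-≤ (2 ^ n) (*-monoʳ-≤ (3 ^ T) (^-monoˡ-≤ u (s≤s (s≤s (s≤s z≤n))))) ⟩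
  3 ^ T * 4 ^ u * 2 ^ n    ≡⟨ swap (3 ^ T) (4 ^ u) (2 ^ n) ⟩
  3 ^ T * 2 ^ n * 4 ^ u    ∎)
  where
  open ≤-Reasoning
  swap : ∀ a b c → a * b * c ≡ a * c * b
  swap = solve-∀

-- Cut [n] into q = ⌊n / 2d⌋ blocks of length 2d and a remainder; each block costs a factor 3/4
-- to the power d, and q d ≥ n / 4.
avoiding-small : ∀ n d T → 1 ≤ d → d + d < n → 4 * T ≤ n → avoiding n d * 4 ^ T ≤ 3 ^ T * 2 ^ n
avoiding-small n d@(suc _) T _ 2d<n 4T≤n = [3/4]^-antitone (avoiding n d) n T≤qd (begin
  avoiding n d * 4 ^ (q * d)                            ≡⟨ cong (λ n → avoiding n d * 4 ^ (q * d)) n≡ ⟩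
  avoiding (q * (d + d) + s) d * 4 ^ (q * d)            ≤⟨ *-monoˡ-≤ _ (avoiding-periodic d q s) ⟩
  3 ^ (q * d) * 2 ^ s * 4 ^ (q * d)                     ≡⟨ cong (3 ^ (q * d) * 2 ^ s *_) (4^n≡2^n*2^n (q * d)) ⟩
  3 ^ (q * d) * 2 ^ s * (2 ^ (q * d) * 2 ^ (q * d))     ≡⟨ reorder (3 ^ (q * d)) (2 ^ s) (2 ^ (q * d)) ⟩
  3 ^ (q * d) * (2 ^ (q * d) * 2 ^ (q * d) * 2 ^ s)     ≡⟨ cong (λ x → 3 ^ (q * d) * (x * 2 ^ s)) (^-distribˡ-+-* 2 (q * d) (q * d)) ⟨
  3 ^ (q * d) * (2 ^ (q * d + q * d) * 2 ^ s)           ≡⟨ cong (3 ^ (q * d) *_) (^-distribˡ-+-* 2 (q * d + q * d) s) ⟨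
  3 ^ (q * d) * 2 ^ (q * d + q * d + s)                 ≡⟨ cong (λ k → 3 ^ (q * d) * 2 ^ k) (trans (cong (_+ s) (double q d)) (sym n≡)) ⟩
  3 ^ (q * d) * 2 ^ n                                   ∎)
  where
  open ≤-Reasoning
  q = n ℕ./ (d + d)
  s = n ℕ.% (d + d)
  n≡ : n ≡ q * (d + d) + s
  n≡ = trans (m≡m%n+[m/n]*n n (d + d)) (+-comm s _)
  s<2d : s < d + d
  s<2d = m%n<n n (d + d)
  2d≤q*2d : d + d ≤ q * (d + d)
  2d≤q*2d = ≤-trans (≤-reflexive (sym (*-identityˡ (d + d)))) (*-monoˡ-≤ (d + d) 1≤q)
    where
    1≤q : 1 ≤ q
    1≤q = m≥n⇒m/n>0 (<⇒≤ 2d<n)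
  n≤4qd : n ≤ 4 * (q * d)
  n≤4qd = ≤-trans (≤-reflexive n≡) (≤-trans (+-monoʳ-≤ (q * (d + d)) (≤-trans (<⇒≤ s<2d) 2d≤q*2d))
                                            (≤-reflexive (quadruple q d)))
    where
    quadruple : ∀ q d → q * (d + d) + q * (d + d) ≡ 4 * (q * d)
    quadruple = solve-∀
  T≤qd : T ≤ q * d
  T≤qd = *-cancelˡ-≤ 4 (≤-trans 4T≤n n≤4qd)
  reorder : ∀ a b c → a * b * (c * c) ≡ a * (c * c * b)
  reorder = solve-∀
  double : ∀ q d → q * d + q * d ≡ q * (d + d)
  double = solve-∀

-- Writing n = 2j + e and d = j + e (possible as d ≤ n ≤ 2d), a single window covers [n].
avoiding-large : ∀ n d → d ≤ n → n ≤ d + d → avoiding n d * 4 ^ n ≤ 2 ^ n * (3 ^ (n ∸ d) * 4 ^ d)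
avoiding-large n d d≤n n≤2d with m≤n⇒∃[o]m+o≡n d≤n
... | j , refl with m≤n⇒∃[o]m+o≡n (+-cancelˡ-≤ d j d n≤2d)
... | e , refl = begin
  avoiding (j + e + j) (j + e) * 4 ^ (j + e + j)
    ≡⟨ cong (λ k → avoiding k (j + e) * 4 ^ (j + e + j)) (layout j e) ⟩
  avoiding (j + (e + (j + 0))) (j + e) * 4 ^ (j + e + j)
    ≤⟨ *-monoˡ-≤ _ (avoiding-window j e 0) ⟩
  3 ^ j * 2 ^ e * 1 * 4 ^ (j + e + j)
    ≡⟨ cong (λ x → 3 ^ j * 2 ^ e * 1 * x) (4^n≡2^n*2^n (j + e + j)) ⟩
  3 ^ j * 2 ^ e * 1 * (2 ^ (j + e + j) * 2 ^ (j + e + j))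
    ≡⟨ cong (λ x → 3 ^ j * 2 ^ e * 1 * (x * x)) (2^[a+b+c] j e j) ⟩
  3 ^ j * 2 ^ e * 1 * ((2 ^ j * 2 ^ e * 2 ^ j) * (2 ^ j * 2 ^ e * 2 ^ j))
    ≡⟨ reorder (3 ^ j) (2 ^ e) (2 ^ j) ⟩
  (2 ^ j * 2 ^ e * 2 ^ j) * (3 ^ j * ((2 ^ j * 2 ^ e) * (2 ^ j * 2 ^ e)))
    ≡⟨ cong₂ (λ x y → x * (3 ^ j * y)) (sym (2^[a+b+c] j e j))
             (sym (trans (4^n≡2^n*2^n (j + e)) (cong (λ x → x * x) (^-distribˡ-+-* 2 j e)))) ⟩
  2 ^ (j + e + j) * (3 ^ j * 4 ^ (j + e))
    ≡⟨ cong (λ k → 2 ^ (j + e + j) * (3 ^ k * 4 ^ (j + e))) (m+n∸m≡n (j + e) j) ⟨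
  2 ^ (j + e + j) * (3 ^ (j + e + j ∸ (j + e)) * 4 ^ (j + e)) ∎
  where
  open ≤-Reasoning
  layout : ∀ j e → j + e + j ≡ j + (e + (j + 0))
  layout = solve-∀
  2^[a+b+c] : ∀ a b c → 2 ^ (a + b + c) ≡ 2 ^ a * 2 ^ b * 2 ^ c
  2^[a+b+c] a b c = trans (^-distribˡ-+-* 2 (a + b) c) (cong (_* 2 ^ c) (^-distribˡ-+-* 2 a b))
  reorder : ∀ x y z → x * y * 1 * ((z * y * z) * (z * y * z)) ≡ (z * y * z) * (x * ((z * y) * (z * y)))
  reorder = solve-∀

geometric-sum : ∀ L M → L ≤ M → sumBelow L (λ d → 3 ^ (M ∸ d) * 4 ^ d) ≤ 3 ^ suc (M ∸ L) * 4 ^ L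
geometric-sum zero    M _     = z≤n
geometric-sum (suc L) M 1+L≤M = begin
  sumBelow (suc L) F                                   ≡⟨ sumBelow-last L F ⟩
  sumBelow L F + F L                                   ≤⟨ +-monoˡ-≤ (F L) (geometric-sum L M (≤-trans (n≤1+n L) 1+L≤M)) ⟩
  3 ^ suc (M ∸ L) * 4 ^ L + 3 ^ (M ∸ L) * 4 ^ L        ≡⟨ cong (λ x → 3 ^ suc x * 4 ^ L + 3 ^ x * 4 ^ L) (+-∸-assoc 1 1+L≤M) ⟩
  3 ^ suc (suc a) * 4 ^ L + 3 ^ suc a * 4 ^ L          ≡⟨ 3·4ᴸ+4ᴸ≡4ᴸ⁺¹ (3 ^ a) (4 ^ L) ⟩
  3 ^ suc a * 4 ^ suc L                                ∎
  where
  open ≤-Reasoning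
  F = λ d → 3 ^ (M ∸ d) * 4 ^ d
  a = M ∸ suc L
  3·4ᴸ+4ᴸ≡4ᴸ⁺¹ : ∀ x y → 3 * (3 * x) * y + 3 * x * y ≡ 3 * x * (4 * y)
  3·4ᴸ+4ᴸ≡4ᴸ⁺¹ = solve-∀

3^n*[3+n]≤3*4^n : ∀ n → 3 ^ n * (3 + n) ≤ 3 * 4 ^ n
3^n*[3+n]≤3*4^n zero    = ≤-refl
3^n*[3+n]≤3*4^n (suc n) = begin
  3 * 3 ^ n * (3 + suc n)                    ≡⟨ expand (3 ^ n) n ⟩
  3 * (3 ^ n * (3 + n)) + 3 ^ n * 3          ≤⟨ +-monoʳ-≤ (3 * (3 ^ n * (3 + n))) (*-monoʳ-≤ (3 ^ n) (m≤m+n 3 n)) ⟩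
  3 * (3 ^ n * (3 + n)) + 3 ^ n * (3 + n)    ≡⟨ collect (3 ^ n * (3 + n)) ⟩
  4 * (3 ^ n * (3 + n))                      ≤⟨ *-monoʳ-≤ 4 (3^n*[3+n]≤3*4^n n) ⟩
  4 * (3 * 4 ^ n)                            ≡⟨ *-comm 4 (3 * 4 ^ n) ⟩
  3 * 4 ^ n * 4                              ≡⟨ *-assoc 3 (4 ^ n) 4 ⟩
  3 * (4 ^ n * 4)                            ≡⟨ cong (3 *_) (*-comm (4 ^ n) 4) ⟩
  3 * 4 ^ suc n                              ∎
  where
  open ≤-Reasoning
  expand : ∀ x n → 3 * x * (3 + suc n) ≡ 3 * (x * (3 + n)) + x * 3
  expand = solve-∀
  collect : ∀ y → 3 * y + y ≡ 4 * y
  collect = solve-∀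

-- With T = 2 ⌊n/8⌋: 4 T ≤ n, while (3/4)^T is small enough to absorb the factor n q.
exp-beats-linear : ∀ q n → 576 * q ≤ n → ∃[ T ] 4 * T ≤ n × n * 3 ^ T * q ≤ 4 ^ T
exp-beats-linear q n 576q≤n = U + U , 4T≤n , decay
  where
  U = n ℕ./ 8
  n≡ : n ≡ n ℕ.% 8 + U * 8
  n≡ = m≡m%n+[m/n]*n n 8
  4T≤n : 4 * (U + U) ≤ n
  4T≤n = ≤-trans (≤-reflexive (eight U)) (≤-trans (m≤n+m (U * 8) (n ℕ.% 8)) (≤-reflexive (sym n≡)))
    where
    eight : ∀ U → 4 * (U + U) ≡ U * 8
    eight = solve-∀
  n<8[U+1] : n < 8 * (U + 1)
  n<8[U+1] = subst (_< 8 * (U + 1)) (sym n≡) (≤-trans (+-monoˡ-≤ (U * 8) (m%n<n n 8)) (≤-reflexive (eight U)))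
    where
    eight : ∀ U → 8 + U * 8 ≡ 8 * (U + 1)
    eight = solve-∀
  72q≤U : 72 * q ≤ U
  72q≤U = ≤-pred (subst (72 * q <_) (+-comm U 1)
    (*-cancelˡ-< 8 (72 * q) (U + 1) (≤-<-trans (≤-reflexive (sym (*-assoc 8 72 q))) (≤-<-trans 576q≤n n<8[U+1]))))
  nq9≤[3+U]² : n * q * 9 ≤ (3 + U) * (3 + U)
  nq9≤[3+U]² = begin
    n * q * 9             ≤⟨ *-monoˡ-≤ 9 (*-monoˡ-≤ q (<⇒≤ n<8[U+1])) ⟩
    8 * (U + 1) * q * 9   ≡⟨ regroup U q ⟩
    (U + 1) * (72 * q)    ≤⟨ *-monoʳ-≤ (U + 1) (≤-trans 72q≤U (m≤n+m U 3)) ⟩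
    (U + 1) * (3 + U)     ≤⟨ *-monoˡ-≤ (3 + U) (≤-trans (≤-reflexive (+-comm U 1)) (s≤s (m≤n+m U 2))) ⟩
    (3 + U) * (3 + U)     ∎
    where
    open ≤-Reasoning
    regroup : ∀ U q → 8 * (U + 1) * q * 9 ≡ (U + 1) * (72 * q)
    regroup = solve-∀
  decay : n * 3 ^ (U + U) * q ≤ 4 ^ (U + U)
  decay = *-cancelʳ-≤ _ _ 9 (begin
    n * 3 ^ (U + U) * q * 9                  ≡⟨ cong (λ x → n * x * q * 9) (^-distribˡ-+-* 3 U U) ⟩
    n * (3 ^ U * 3 ^ U) * q * 9              ≡⟨ regroup n (3 ^ U) q ⟩
    (n * q * 9) * (3 ^ U * 3 ^ U)            ≤⟨ *-monoˡ-≤ _ nq9≤[3+U]² ⟩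
    (3 + U) * (3 + U) * (3 ^ U * 3 ^ U)      ≡⟨ square (3 + U) (3 ^ U) ⟩
    (3 ^ U * (3 + U)) * (3 ^ U * (3 + U))    ≤⟨ *-mono-≤ (3^n*[3+n]≤3*4^n U) (3^n*[3+n]≤3*4^n U) ⟩
    (3 * 4 ^ U) * (3 * 4 ^ U)                ≡⟨ square′ (4 ^ U) ⟩
    4 ^ U * 4 ^ U * 9                        ≡⟨ cong (_* 9) (^-distribˡ-+-* 4 U U) ⟨
    4 ^ (U + U) * 9                          ∎)
    where
    open ≤-Reasoning
    regroup : ∀ n x q → n * (x * x) * q * 9 ≡ (n * q * 9) * (x * x)
    regroup = solve-∀
    square : ∀ a x → a * a * (x * x) ≡ (x * a) * (x * a)
    square = solve-∀
    square′ : ∀ y → (3 * y) * (3 * y) ≡ y * y * 9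
    square′ = solve-∀

largeGaps smallGaps : ℕ → ℕ → ℕ
largeGaps N L = sumBelow L (λ d → if isYes (N ≤? d + d) then avoiding N d else 0)
smallGaps N L = sumBelow L (λ d → if isYes (N ≤? d + d) then 0 else avoiding N d)

sumBelow-avoiding≡large+small : ∀ N L → sumBelow L (avoiding N) ≡ largeGaps N L + smallGaps N L
sumBelow-avoiding≡large+small N L = trans (sumBelow-cong L (λ d _ → split d)) (sumBelow-distrib-+ L _ _)
  where
  split : ∀ d → avoiding N d ≡ (if isYes (N ≤? d + d) then avoiding N d else 0)
                             + (if isYes (N ≤? d + d) then 0 else avoiding N d)
  split d with N ≤? d + d
  ... | yes _ = sym (+-identityʳ _)
  ... | no  _ = refl

largeGaps-bound : ∀ N L → L ≤ N → largeGaps N L * 4 ^ (N ∸ L) ≤ 3 ^ suc (N ∸ L) * 2 ^ N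
largeGaps-bound N L L≤N = *-cancelʳ-≤ _ _ (4 ^ L) {{m^n≢0 4 L}} (begin
  largeGaps N L * 4 ^ M * 4 ^ L                    ≡⟨ *-assoc (largeGaps N L) _ _ ⟩
  largeGaps N L * (4 ^ M * 4 ^ L)                  ≡⟨ cong (largeGaps N L *_) 4ᴹ4ᴸ≡4ᴺ ⟩
  largeGaps N L * 4 ^ N                            ≡⟨ sumBelow-*ʳ L (4 ^ N) _ ⟨
  sumBelow L (λ d → large d * 4 ^ N)               ≤⟨ sumBelow-mono-≤ L pointwise ⟩
  sumBelow L (λ d → 2 ^ N * (3 ^ (N ∸ d) * 4 ^ d)) ≡⟨ sumBelow-*ˡ L (2 ^ N) _ ⟩
  2 ^ N * sumBelow L (λ d → 3 ^ (N ∸ d) * 4 ^ d)   ≤⟨ *-monoʳ-≤ (2 ^ N) (geometric-sum L N L≤N) ⟩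
  2 ^ N * (3 ^ suc M * 4 ^ L)                      ≡⟨ *-assoc (2 ^ N) _ _ ⟨
  2 ^ N * 3 ^ suc M * 4 ^ L                        ≡⟨ cong (_* 4 ^ L) (*-comm (2 ^ N) _) ⟩
  3 ^ suc M * 2 ^ N * 4 ^ L                        ∎)
  where
  open ≤-Reasoning
  M = N ∸ L
  large : ℕ → ℕ
  large d = if isYes (N ≤? d + d) then avoiding N d else 0
  4ᴹ4ᴸ≡4ᴺ : 4 ^ M * 4 ^ L ≡ 4 ^ N
  4ᴹ4ᴸ≡4ᴺ = trans (sym (^-distribˡ-+-* 4 M L)) (cong (4 ^_) (trans (+-comm M L) (m+[n∸m]≡n L≤N)))
  pointwise : ∀ d → d < L → large d * 4 ^ N ≤ 2 ^ N * (3 ^ (N ∸ d) * 4 ^ d)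
  pointwise d d<L with N ≤? d + d
  ... | yes N≤2d = avoiding-large N d (≤-trans (<⇒≤ d<L) L≤N) N≤2d
  ... | no  _    = z≤n

smallGaps-bound : ∀ N L D → L ≤ N → 576 * D + 3 ≤ N → smallGaps N L * D ≤ 2 ^ N
smallGaps-bound N L D L≤N N-large = *-cancelʳ-≤ _ _ (4 ^ T) {{m^n≢0 4 T}} (begin
  smallGaps N L * D * 4 ^ T            ≡⟨ swap (smallGaps N L) D (4 ^ T) ⟩
  smallGaps N L * 4 ^ T * D            ≤⟨ *-monoˡ-≤ D sum-bound ⟩
  N * (3 ^ T * 2 ^ N) * D              ≡⟨ regroup N (3 ^ T) (2 ^ N) D ⟩
  N * 3 ^ T * D * 2 ^ N                ≤⟨ *-monoˡ-≤ (2 ^ N) decay ⟩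
  4 ^ T * 2 ^ N                        ≡⟨ *-comm (4 ^ T) (2 ^ N) ⟩
  2 ^ N * 4 ^ T                        ∎)
  where
  open ≤-Reasoning
  T-good = exp-beats-linear D N (≤-trans (m≤m+n (576 * D) 3) N-large)
  T = proj₁ T-good
  4T≤N = proj₁ (proj₂ T-good)
  decay = proj₂ (proj₂ T-good)
  small : ℕ → ℕ
  small d = if isYes (N ≤? d + d) then 0 else avoiding N d
  2<N : 2 < N
  2<N = ≤-trans (m≤n+m 3 (576 * D)) N-large
  pointwise : ∀ d → d < L → small d * 4 ^ T ≤ 3 ^ T * 2 ^ N
  pointwise d _ with N ≤? d + d
  ... | yes _ = z≤n
  pointwise zero    _ | no _   = ≤-trans (*-monoˡ-≤ (4 ^ T) (avoiding-0≤avoiding-1 N)) (avoiding-small N 1 T ≤-refl 2<N 4T≤N)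
  pointwise (suc d) _ | no N≰2d = avoiding-small N (suc d) T (s≤s z≤n) (≰⇒> N≰2d) 4T≤N
  sum-bound : smallGaps N L * 4 ^ T ≤ N * (3 ^ T * 2 ^ N)
  sum-bound = begin
    smallGaps N L * 4 ^ T                ≡⟨ sumBelow-*ʳ L (4 ^ T) small ⟨
    sumBelow L (λ d → small d * 4 ^ T)   ≤⟨ sumBelow-≤-* L _ pointwise ⟩
    L * (3 ^ T * 2 ^ N)                  ≤⟨ *-monoˡ-≤ _ L≤N ⟩
    N * (3 ^ T * 2 ^ N)                  ∎
  swap : ∀ a b c → a * b * c ≡ a * c * b
  swap = solve-∀
  regroup : ∀ n a b d → n * (a * b) * d ≡ n * a * d * b
  regroup = solve-∀

-- Agreement with the definitions of P and f

does⁻ : ∀ {A : Set} (a? : Dec A) → does a? ≡ true → A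
does⁻ (yes a) _ = a

does-≡ᵇ : ∀ {A : Set} (a? : Dec A) {b} → (A → b ≡ true) → (b ≡ true → A) → does a? ≡ b
does-≡ᵇ a? A⇒b b⇒A = ≡-from-⇔ (λ a → A⇒b (does⁻ a? a)) (λ b → dec-true a? (b⇒A b))

countL : ∀ {A : Set} → (A → Bool) → List A → ℕ
countL p []       = 0
countL p (x ∷ xs) = 𝟙 (p x) + countL p xs

countL-++ : ∀ {A : Set} (p : A → Bool) xs ys → countL p (xs ++ₗ ys) ≡ countL p xs + countL p ys
countL-++ p []       ys = refl
countL-++ p (x ∷ xs) ys = trans (cong (𝟙 (p x) +_) (countL-++ p xs ys)) (sym (+-assoc (𝟙 (p x)) _ _))

countL-map : ∀ {A B : Set} (p : B → Bool) (F : A → B) xs → countL p (map F xs) ≡ countL (λ x → p (F x)) xs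
countL-map p F []       = refl
countL-map p F (x ∷ xs) = cong (𝟙 (p (F x)) +_) (countL-map p F xs)

countL-applyUpTo : ∀ {A : Set} (p : A → Bool) (F : ℕ → A) n →
  countL p (applyUpTo F n) ≡ countBelow n (λ i → p (F i))
countL-applyUpTo p F zero    = refl
countL-applyUpTo p F (suc n) = cong (𝟙 (p (F 0)) +_) (countL-applyUpTo p (λ i → F (suc i)) n)

length-filter : ∀ {A : Set} {P : A → Set} (P? : ∀ x → Dec (P x)) xs →
  length (filter P? xs) ≡ countL (λ x → does (P? x)) xs
length-filter P? []       = refl
length-filter P? (x ∷ xs) with does (P? x)
... | true  = cong suc (length-filter P? xs)
... | false = length-filter P? xs

countL-allSubsets : ∀ n (p : Subset n → Bool) → countL p (allSubsets n) ≡ count n p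
countL-allSubsets zero    p = +-identityʳ _
countL-allSubsets (suc n) p = trans (countL-++ p (map (true ∷_) (allSubsets n)) _)
  (cong₂ _+_ (trans (countL-map p (true ∷_) (allSubsets n)) (countL-allSubsets n _))
             (trans (countL-map p (false ∷_) (allSubsets n)) (countL-allSubsets n _)))

countSubsets≡count : ∀ n {P : Subset n → Set} (P? : ∀ S → Dec (P S)) →
  countSubsets n P? ≡ count n (λ S → does (P? S))
countSubsets≡count n P? = trans (length-filter P? (allSubsets n)) (countL-allSubsets n _)

∈⇒member : ∀ {n} (S : Subset n) (x : Fin n) → x ∈ S → member S (toℕ x) ≡ true
∈⇒member (b ∷ S) fzero    here      = refl
∈⇒member (b ∷ S) (fsuc x) (there p) = ∈⇒member S x p

member⇒∈ : ∀ {n} (S : Subset n) y → member S y ≡ true → Σ (Fin n) λ x → toℕ x ≡ y × x ∈ S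
member⇒∈ (true ∷ S) zero    refl = fzero , refl , here
member⇒∈ (b    ∷ S) (suc y) y∈S with member⇒∈ S y y∈S
... | x , refl , x∈S = fsuc x , refl , there x∈S

[+a]-[+b]≡+d⇒a≡b+d : ∀ a b d → ℤ.+ a ℤ.- ℤ.+ b ≡ ℤ.+ d → a ≡ b + d
[+a]-[+b]≡+d⇒a≡b+d a b d a-b≡d = ℤₚ.+-injective (begin
  ℤ.+ a                         ≡⟨ cancel (ℤ.+ a) (ℤ.+ b) ⟩
  ℤ.+ b ℤ.+ (ℤ.+ a ℤ.- ℤ.+ b)   ≡⟨ cong (ℤ._+_ (ℤ.+ b)) a-b≡d ⟩
  ℤ.+ b ℤ.+ ℤ.+ d               ≡⟨ ℤₚ.pos-+ b d ⟨
  ℤ.+ (b + d)                   ∎)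
  where
  open ≡-Reasoning
  cancel : ∀ x y → x ≡ y ℤ.+ (x ℤ.- y)
  cancel = ℤ-solve-∀

[+[b+d]]-[+b]≡+d : ∀ b d → ℤ.+ (b + d) ℤ.- ℤ.+ b ≡ ℤ.+ d
[+[b+d]]-[+b]≡+d b d = trans (cong (ℤ._- ℤ.+ b) (ℤₚ.pos-+ b d)) (cancel (ℤ.+ b) (ℤ.+ d))
  where
  cancel : ∀ x y → x ℤ.+ y ℤ.- x ≡ y
  cancel = ℤ-solve-∀

[+y]-[+x]≡-[[+x]-[+y]] : ∀ x y → ℤ.+ y ℤ.- ℤ.+ x ≡ ℤ.- (ℤ.+ x ℤ.- ℤ.+ y)
[+y]-[+x]≡-[[+x]-[+y]] x y = swap (ℤ.+ x) (ℤ.+ y)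
  where
  swap : ∀ x y → y ℤ.- x ≡ ℤ.- (x ℤ.- y)
  swap = ℤ-solve-∀

∈Diff⇒hasDiff : ∀ {n} (S : Subset n) d → (ℤ.+ d) ∈Diff S → hasDiff S d ≡ true
∈Diff⇒hasDiff S d (x , y , x∈S , y∈S , x-y≡d) = hasDiff⁺ S d (toℕ y) (∈⇒member S y y∈S)
  (trans (cong (member S) (sym ([+a]-[+b]≡+d⇒a≡b+d (toℕ x) (toℕ y) d x-y≡d))) (∈⇒member S x x∈S))

hasDiff⇒∈Diff : ∀ {n} (S : Subset n) d → hasDiff S d ≡ true → (ℤ.+ d) ∈Diff S
hasDiff⇒∈Diff S d diff with hasDiff⁻ S d diff
... | y , y∈S , y+d∈S with member⇒∈ S y y∈S | member⇒∈ S (y + d) y+d∈S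
...   | y′ , refl , y′∈S | x′ , x′≡y+d , x′∈S =
  x′ , y′ , x′∈S , y′∈S , trans (cong (λ k → ℤ.+ k ℤ.- ℤ.+ toℕ y′) x′≡y+d) ([+[b+d]]-[+b]≡+d (toℕ y′) d)

∈Diff-neg : ∀ {n} (S : Subset n) z → z ∈Diff S → (ℤ.- z) ∈Diff S
∈Diff-neg S z (x , y , x∈S , y∈S , x-y≡z) =
  y , x , y∈S , x∈S , trans ([+y]-[+x]≡-[[+x]-[+y]] (toℕ x) (toℕ y)) (cong ℤ.-_ x-y≡z)

∈Diff?≡hasDiff : ∀ {n} (S : Subset n) d → does ((ℤ.+ d) ∈Diff? S) ≡ hasDiff S d
∈Diff?≡hasDiff S d = does-≡ᵇ ((ℤ.+ d) ∈Diff? S) (∈Diff⇒hasDiff S d) (hasDiff⇒∈Diff S d)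

-∈Diff?≡hasDiff : ∀ {n} (S : Subset n) d → does ((ℤ.- ℤ.+ d) ∈Diff? S) ≡ hasDiff S d
-∈Diff?≡hasDiff S d = does-≡ᵇ ((ℤ.- ℤ.+ d) ∈Diff? S)
  (λ -d∈ → ∈Diff⇒hasDiff S d (subst (_∈Diff S) (ℤₚ.neg-involutive (ℤ.+ d)) (∈Diff-neg S _ -d∈)))
  (λ diff → ∈Diff-neg S _ (hasDiff⇒∈Diff S d diff))

upperDiffSize≡ : ∀ m (T : Subset (2 * m)) → upperDiffSize m T ≡ countBelow m (λ j → hasDiff T (m + j))
upperDiffSize≡ m T = begin
  upperDiffSize m T
    ≡⟨ length-filter (λ d → (ℤ.+ d) ∈Diff? T) (map (m +_) (upTo m)) ⟩
  countL (λ d → does ((ℤ.+ d) ∈Diff? T)) (map (m +_) (upTo m))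
    ≡⟨ countL-map _ (m +_) (upTo m) ⟩
  countL (λ j → does ((ℤ.+ (m + j)) ∈Diff? T)) (upTo m)
    ≡⟨ countL-applyUpTo _ (λ i → i) m ⟩
  countBelow m (λ j → does ((ℤ.+ (m + j)) ∈Diff? T))
    ≡⟨ countBelow-cong m (λ j _ → ∈Diff?≡hasDiff T (m + j)) ⟩
  countBelow m (λ j → hasDiff T (m + j)) ∎
  where open ≡-Reasoning

countBelow-hasDiff : ∀ {n} (S : Subset n) →
  countBelow n (hasDiff S) ≡ 𝟙 (hasDiff S 0) + countBelow n (λ i → hasDiff S (suc i))
countBelow-hasDiff {n} S = begin
  countBelow n (hasDiff S)                        ≡⟨ +-identityʳ _ ⟨
  countBelow n (hasDiff S) + 0                    ≡⟨ cong (λ b → countBelow n (hasDiff S) + 𝟙 b) (hasDiff-size S) ⟨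
  countBelow n (hasDiff S) + 𝟙 (hasDiff S n)      ≡⟨ sumBelow-last n (λ i → 𝟙 (hasDiff S i)) ⟨
  countBelow (suc n) (hasDiff S)                  ∎
  where open ≡-Reasoning

diffSize≡countBelow : ∀ {n} (S : Subset n) →
  diffSize S ≡ countBelow (suc (2 * n)) (λ i → does ((ℤ.+ i ℤ.- ℤ.+ n) ∈Diff? S))
diffSize≡countBelow {n} S =
  trans (length-filter (λ d → d ∈Diff? S) (map (λ i → ℤ.+ i ℤ.- ℤ.+ n) (upTo (suc (2 * n)))))
    (trans (countL-map (λ z → does (z ∈Diff? S)) (λ i → ℤ.+ i ℤ.- ℤ.+ n) (upTo (suc (2 * n))))
           (countL-applyUpTo _ (λ i → i) (suc (2 * n))))

-- S - S is symmetric and contains 0 iff S is nonempty, so it is counted by its nonnegative part.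
diffSize+𝟙[0∈S-S]≡2*countBelow : ∀ {n} (S : Subset n) →
  diffSize S + 𝟙 (hasDiff S 0) ≡ 2 * countBelow n (hasDiff S)
diffSize+𝟙[0∈S-S]≡2*countBelow {n} S = begin
  diffSize S + h₀
    ≡⟨ cong (_+ h₀) (diffSize≡countBelow S) ⟩
  countBelow (suc (2 * n)) δ + h₀
    ≡⟨ cong (λ k → countBelow k δ + h₀) (trans (cong (λ k → suc (n + k)) (+-identityʳ n)) (sym (+-suc n n))) ⟩
  countBelow (n + suc n) δ + h₀
    ≡⟨ cong (_+ h₀) (sumBelow-+ n (suc n) (λ i → 𝟙 (δ i))) ⟩
  countBelow n δ + (𝟙 (δ (n + 0)) + countBelow n (λ i → δ (n + suc i))) + h₀
    ≡⟨ cong₂ (λ a b → a + (𝟙 b + countBelow n (λ i → δ (n + suc i))) + h₀) negative middle ⟩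
  A + (h₀ + countBelow n (λ i → δ (n + suc i))) + h₀
    ≡⟨ cong (λ c → A + (h₀ + c) + h₀) positive ⟩
  A + (h₀ + A) + h₀
    ≡⟨ collect A h₀ ⟩
  2 * (h₀ + A)
    ≡⟨ cong (2 *_) (countBelow-hasDiff S) ⟨
  2 * countBelow n (hasDiff S) ∎
  where
  open ≡-Reasoning
  h₀ = 𝟙 (hasDiff S 0)
  A = countBelow n (λ i → hasDiff S (suc i))
  δ : ℕ → Bool
  δ i = does ((ℤ.+ i ℤ.- ℤ.+ n) ∈Diff? S)
  i-n≡-[n∸i] : ∀ i → i < n → ℤ.+ i ℤ.- ℤ.+ n ≡ ℤ.- ℤ.+ (n ∸ i)
  i-n≡-[n∸i] i i<n = trans ([+y]-[+x]≡-[[+x]-[+y]] n i)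
    (cong ℤ.-_ (trans (cong (λ k → ℤ.+ k ℤ.- ℤ.+ i) (sym (m+[n∸m]≡n (<⇒≤ i<n)))) ([+[b+d]]-[+b]≡+d i (n ∸ i))))
  negative : countBelow n δ ≡ A
  negative = trans (countBelow-cong n (λ i i<n →
                      trans (cong (λ z → does (z ∈Diff? S)) (i-n≡-[n∸i] i i<n)) (-∈Diff?≡hasDiff S (n ∸ i))))
                   (sumBelow-reverse n (λ i → 𝟙 (hasDiff S i)))
  middle : δ (n + 0) ≡ hasDiff S 0
  middle = trans (cong (λ z → does (z ∈Diff? S)) ([+[b+d]]-[+b]≡+d n 0)) (∈Diff?≡hasDiff S 0)
  positive : countBelow n (λ i → δ (n + suc i)) ≡ A
  positive = countBelow-cong n (λ i _ →
    trans (cong (λ z → does (z ∈Diff? S)) ([+[b+d]]-[+b]≡+d n (suc i))) (∈Diff?≡hasDiff S (suc i)))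
  collect : ∀ a h → a + (h + a) + h ≡ 2 * (h + a)
  collect = solve-∀

P-event? : ∀ n k (S : Subset n) → Dec (ℤ.+ (2 * n) ℤ.- ℤ.+ 1 ℤ.- ℤ.+ diffSize S ≡ ℤ.+ k)
P-event? n k S = (ℤ.+ (2 * n) ℤ.- ℤ.+ 1 ℤ.- ℤ.+ diffSize S) ℤ.≟ ℤ.+ k

[+a]-1-[+b]≡+c⇔a≡c+1+b : ∀ a b c → (ℤ.+ a ℤ.- ℤ.+ 1 ℤ.- ℤ.+ b ≡ ℤ.+ c) ⇔ (a ≡ c + 1 + b)
[+a]-1-[+b]≡+c⇔a≡c+1+b a b c = mk⇔
  (λ eq → ℤₚ.+-injective (trans (undo (ℤ.+ a) (ℤ.+ 1) (ℤ.+ b))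
     (trans (cong (λ z → z ℤ.+ ℤ.+ 1 ℤ.+ ℤ.+ b) eq) (sym pos-c+1+b))))
  (λ { refl → trans (cong (λ z → z ℤ.- ℤ.+ 1 ℤ.- ℤ.+ b) pos-c+1+b) (redo (ℤ.+ c) (ℤ.+ 1) (ℤ.+ b)) })
  where
  pos-c+1+b : ℤ.+ (c + 1 + b) ≡ ℤ.+ c ℤ.+ ℤ.+ 1 ℤ.+ ℤ.+ b
  pos-c+1+b = trans (ℤₚ.pos-+ (c + 1) b) (cong (ℤ._+ ℤ.+ b) (ℤₚ.pos-+ c 1))
  undo : ∀ x y z → x ≡ x ℤ.- y ℤ.- z ℤ.+ y ℤ.+ z
  undo = ℤ-solve-∀
  redo : ∀ x y z → x ℤ.+ y ℤ.+ z ℤ.- y ℤ.- z ≡ x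
  redo = ℤ-solve-∀

parity-event : ∀ {n k c ds} h → ds + 𝟙 h ≡ 2 * c → (2 * n ≡ 2 * k + 1 + ds) ⇔ (h ≡ true × c + k ≡ n)
parity-event {n} {k} {c} {ds} false size≡ = mk⇔ (λ eq → ⊥-elim (even≢odd n (k + c) (begin
  2 * n                  ≡⟨ eq ⟩
  2 * k + 1 + ds         ≡⟨ cong (2 * k + 1 +_) (trans (sym (+-identityʳ ds)) size≡) ⟩
  2 * k + 1 + 2 * c      ≡⟨ odd k c ⟩
  suc (2 * (k + c))      ∎))) (λ ())
  where
  open ≡-Reasoning
  odd : ∀ k c → 2 * k + 1 + 2 * c ≡ suc (2 * (k + c))
  odd = solve-∀
parity-event {n} {k} {c} {ds} true size≡ =
  mk⇔ (λ eq → refl , sym (*-cancelˡ-≡ n (c + k) 2 (trans eq 2k+1+ds≡2[c+k])))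
      (λ { (_ , refl) → sym 2k+1+ds≡2[c+k] })
  where
  open ≡-Reasoning
  2k+1+ds≡2[c+k] : 2 * k + 1 + ds ≡ 2 * (c + k)
  2k+1+ds≡2[c+k] = begin
    2 * k + 1 + ds     ≡⟨ shuffle k ds ⟩
    2 * k + (ds + 1)   ≡⟨ cong (2 * k +_) size≡ ⟩
    2 * k + 2 * c      ≡⟨ factor k c ⟩
    2 * (c + k)        ∎
    where
    shuffle : ∀ k d → 2 * k + 1 + d ≡ 2 * k + (d + 1)
    shuffle = solve-∀
    factor : ∀ k c → 2 * k + 2 * c ≡ 2 * (c + k)
    factor = solve-∀

-- With c = #{d < n : d ∈ S - S}: |S - S| = 2c - 1 for nonempty S, so the event reads c + k = n;
-- for empty S it fails by parity.
P-event≡ : ∀ n k (S : Subset n) →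
  does (P-event? n (2 * k) S) ≡ hasDiff S 0 ∧ does (countBelow n (hasDiff S) + k ≟ n)
P-event≡ n k S = does-≡ᵇ (P-event? n (2 * k) S)
  (λ event → let 0∈S-S , c+k≡n = Equivalence.to parity (Equivalence.to integer event)
             in cong₂ _∧_ 0∈S-S (dec-true (c + k ≟ n) c+k≡n))
  (λ both → Equivalence.from integer (Equivalence.from parity
             (∧-conicalˡ (hasDiff S 0) _ both , does⁻ (c + k ≟ n) (∧-conicalʳ (hasDiff S 0) _ both))))
  where
  c = countBelow n (hasDiff S)
  integer = [+a]-1-[+b]≡+c⇔a≡c+1+b (2 * n) (diffSize S) (2 * k)
  parity = parity-event {n} {k} {c} {diffSize S} (hasDiff S 0) (diffSize+𝟙[0∈S-S]≡2*countBelow S)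

-- A difference a + j ≥ |u| in u ++ w ++ v (with |v| ≤ |u|) must start in u and end in v.
hasDiff-++-gap : ∀ {a b r} (u : Subset a) (w : Subset r) (v : Subset b) → b ≤ a → ∀ j →
  hasDiff (u ++ v) (a + j) ≡ hasDiff (u ++ (w ++ v)) (a + (r + j))
hasDiff-++-gap {a} {b} {r} u w v b≤a j = ≡-from-⇔ to from
  where
  T = u ++ v
  S = u ++ (w ++ v)
  x<a : ∀ x → member v (x + j) ≡ true → x < a
  x<a x x+j∈v = ≤-<-trans (m≤m+n x j) (<-≤-trans (member⇒< v (x + j) x+j∈v) b≤a)
  shiftT : ∀ x → x + (a + j) ≡ a + (x + j)
  shiftT x = x∙yz≈y∙xz x a j
  shiftS : ∀ x → x + (a + (r + j)) ≡ a + (r + (x + j))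
  shiftS x = trans (x∙yz≈y∙xz x a (r + j)) (cong (a +_) (x∙yz≈y∙xz x r j))
  to : hasDiff T (a + j) ≡ true → hasDiff S (a + (r + j)) ≡ true
  to diff with hasDiff⁻ T (a + j) diff
  ... | x , x∈T , x+d∈T = hasDiff⁺ S (a + (r + j)) x
    (trans (member-++ˡ u _ x (x<a x x+j∈v)) (trans (sym (member-++ˡ u v x (x<a x x+j∈v))) x∈T))
    (trans (cong (member S) (shiftS x)) (trans (member-++ʳ u _ _) (trans (member-++ʳ w v _) x+j∈v)))
    where
    x+j∈v : member v (x + j) ≡ true
    x+j∈v = trans (sym (member-++ʳ u v (x + j))) (trans (cong (member T) (sym (shiftT x))) x+d∈T)
  from : hasDiff S (a + (r + j)) ≡ true → hasDiff T (a + j) ≡ true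
  from diff with hasDiff⁻ S (a + (r + j)) diff
  ... | x , x∈S , x+d∈S = hasDiff⁺ T (a + j) x
    (trans (member-++ˡ u v x (x<a x x+j∈v)) (trans (sym (member-++ˡ u _ x (x<a x x+j∈v))) x∈S))
    (trans (cong (member T) (shiftT x)) (trans (member-++ʳ u v _) x+j∈v))
    where
    x+j∈v : member v (x + j) ≡ true
    x+j∈v = trans (sym (member-++ʳ w v (x + j)))
                  (trans (sym (member-++ʳ u _ _)) (trans (cong (member S) (sym (shiftS x))) x+d∈S))

-- Coupling the two events

module Coupling (k m r : ℕ) where

  N : ℕ
  N = m + (r + (m + 0))

  N≡m+r+m : N ≡ m + r + m
  N≡m+r+m = layout m r
    where
    layout : ∀ m r → m + (r + (m + 0)) ≡ m + r + m
    layout = solve-∀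

  good : Subset N → Bool
  good S = allBelow (m + r) (hasDiff S)

  P-event : Subset N → Bool
  P-event S = hasDiff S 0 ∧ does (countBelow N (hasDiff S) + k ≟ N)

  upper : Subset N → ℕ
  upper S = countBelow m (λ j → hasDiff S (m + (r + j)))

  f-event : Subset N → Bool
  f-event S = does (upper S ≟ m ∸ k)

  -- On good S the differences below m + r are all present, so the count in P-event is m + r + upper S.
  P-event≡f-event : k < m → ∀ S → good S ≡ true → P-event S ≡ f-event S
  P-event≡f-event k<m S all = trans (cong (_∧ does (c + k ≟ N)) 0∈S-S) (does-⇔ (mk⇔ to from) (c + k ≟ N) (upper S ≟ m ∸ k))
    where
    c = countBelow N (hasDiff S)
    0∈S-S : hasDiff S 0 ≡ true
    0∈S-S = allBelow⁻ (m + r) (hasDiff S) all 0 (<-≤-trans (≤-<-trans z≤n k<m) (m≤m+n m r))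
    c≡ : c ≡ (m + r) + upper S
    c≡ = begin
      c                                                      ≡⟨ sumBelow-+ m (r + (m + 0)) _ ⟩
      countBelow m (hasDiff S) + countBelow (r + (m + 0)) (λ i → hasDiff S (m + i))
        ≡⟨ cong (countBelow m (hasDiff S) +_) (sumBelow-+ r (m + 0) _) ⟩
      countBelow m (hasDiff S) + (countBelow r (λ i → hasDiff S (m + i)) + countBelow (m + 0) (λ i → hasDiff S (m + (r + i))))
        ≡⟨ +-assoc (countBelow m (hasDiff S)) _ _ ⟨
      countBelow m (hasDiff S) + countBelow r (λ i → hasDiff S (m + i)) + countBelow (m + 0) (λ i → hasDiff S (m + (r + i)))
        ≡⟨ cong₂ _+_ (trans (sym (sumBelow-+ m r _)) (allBelow⇒countBelow≡ (m + r) (hasDiff S) all))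
                     (cong (λ l → countBelow l (λ i → hasDiff S (m + (r + i)))) (+-identityʳ m)) ⟩
      (m + r) + upper S                                      ∎
      where open ≡-Reasoning
    to : c + k ≡ N → upper S ≡ m ∸ k
    to c+k≡N = trans (sym (m+n∸n≡m (upper S) k)) (cong (_∸ k) (+-cancelˡ-≡ (m + r) _ _ (begin
      m + r + (upper S + k)     ≡⟨ +-assoc (m + r) _ k ⟨
      m + r + upper S + k       ≡⟨ cong (_+ k) c≡ ⟨
      c + k                     ≡⟨ trans c+k≡N N≡m+r+m ⟩
      m + r + m                 ∎)))
      where open ≡-Reasoning
    from : upper S ≡ m ∸ k → c + k ≡ N
    from upper≡ = begin
      c + k                     ≡⟨ cong (_+ k) c≡ ⟩
      m + r + upper S + k       ≡⟨ +-assoc (m + r) _ k ⟩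
      m + r + (upper S + k)     ≡⟨ cong (λ x → m + r + (x + k)) upper≡ ⟩
      m + r + (m ∸ k + k)       ≡⟨ cong (m + r +_) (m∸n+n≡m (<⇒≤ k<m)) ⟩
      m + r + m                 ≡⟨ N≡m+r+m ⟨
      N                         ∎
      where open ≡-Reasoning

  Y : ℕ
  Y = countSubsets (2 * m) (λ T → upperDiffSize m T ≟ (m ∸ k))

  count-f-event : count N f-event ≡ 2 ^ r * Y
  count-f-event = begin
    count N f-event
      ≡⟨ sumSubsets-++ m _ _ ⟩
    sumSubsets m (λ u → sumSubsets (r + (m + 0)) (λ z → 𝟙 (f-event (u ++ z))))
      ≡⟨ sumSubsets-cong m (λ u → sumSubsets-++ r _ _) ⟩
    sumSubsets m (λ u → sumSubsets r (λ w → sumSubsets (m + 0) (λ v → 𝟙 (f-event (u ++ (w ++ v))))))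
      ≡⟨ sumSubsets-cong m (λ u → sumSubsets-cong r (λ w → sumSubsets-cong (m + 0) (λ v → cong 𝟙 (drop-w u w v)))) ⟩
    sumSubsets m (λ u → sumSubsets r (λ w → sumSubsets (m + 0) (λ v → Φ (u ++ v))))
      ≡⟨ sumSubsets-cong m (λ u → sumSubsets-const r _) ⟩
    sumSubsets m (λ u → 2 ^ r * sumSubsets (m + 0) (λ v → Φ (u ++ v)))
      ≡⟨ sumSubsets-*ˡ m (2 ^ r) _ ⟩
    2 ^ r * sumSubsets m (λ u → sumSubsets (m + 0) (λ v → Φ (u ++ v)))
      ≡⟨ cong (2 ^ r *_) (sumSubsets-++ m (m + 0) Φ) ⟨
    2 ^ r * count (2 * m) (λ T → does (upperDiffSize m T ≟ (m ∸ k)))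
      ≡⟨ cong (2 ^ r *_) (countSubsets≡count (2 * m) (λ T → upperDiffSize m T ≟ (m ∸ k))) ⟨
    2 ^ r * Y ∎
    where
    open ≡-Reasoning
    Φ : Subset (2 * m) → ℕ
    Φ T = 𝟙 (does (upperDiffSize m T ≟ (m ∸ k)))
    drop-w : ∀ u w v → f-event (u ++ (w ++ v)) ≡ does (upperDiffSize m (u ++ v) ≟ (m ∸ k))
    drop-w u w v = cong (λ z → does (z ≟ (m ∸ k)))
      (trans (countBelow-cong m (λ j _ → sym (hasDiff-++-gap u w v (≤-reflexive (+-identityʳ m)) j)))
             (sym (upperDiffSize≡ m (u ++ v))))

  X : ℕ
  X = countSubsets N (P-event? N (2 * k))

  X≡count-P-event : X ≡ count N P-event
  X≡count-P-event = trans (countSubsets≡count N (P-event? N (2 * k))) (sumSubsets-cong N (λ S → cong 𝟙 (P-event≡ N k S)))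

  bad : ℕ
  bad = count N (λ S → not (good S))

  bad≤sumBelow-avoiding : bad ≤ sumBelow (m + r) (avoiding N)
  bad≤sumBelow-avoiding = ≤-trans (sumSubsets-mono-≤ N (λ S → union-bound (m + r) (hasDiff S)))
                 (≤-reflexive (sumSubsets-sumBelow N (m + r) (λ S d → 𝟙 (not (hasDiff S d)))))

  X≤2^rY+bad : k < m → X ≤ 2 ^ r * Y + bad
  X≤2^rY+bad k<m = begin
    X                            ≡⟨ X≡count-P-event ⟩
    count N P-event              ≤⟨ count≤count+exceptions N P-event f-event good (P-event≡f-event k<m) ⟩
    count N f-event + bad        ≡⟨ cong (_+ bad) count-f-event ⟩
    2 ^ r * Y + bad              ∎
    where open ≤-Reasoning

  2^rY≤X+bad : k < m → 2 ^ r * Y ≤ X + bad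
  2^rY≤X+bad k<m = begin
    2 ^ r * Y                    ≡⟨ count-f-event ⟨
    count N f-event              ≤⟨ count≤count+exceptions N f-event P-event good (λ S g → sym (P-event≡f-event k<m S g)) ⟩
    count N P-event + bad        ≡⟨ cong (_+ bad) X≡count-P-event ⟨
    X + bad                      ∎
    where open ≤-Reasoning

  N≡2m+r : N ≡ 2 * m + r
  N≡2m+r = layout m r
    where
    layout : ∀ m r → m + (r + (m + 0)) ≡ 2 * m + r
    layout = solve-∀

  ∣P-f∣≤4·¾^[m+1]+ε : k < m → ∀ D ε .{{_ : NonZero D}} → ι 1 Q.≤ ε Q.* ι D → 576 * D + 3 ≤ N →
    ∣ P N (2 * k) - f k m ∣ Q.≤ ι 4 Q.* ¾ ^ℚ (m + 1) Q.+ ε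
  ∣P-f∣≤4·¾^[m+1]+ε k<m D ε 1≤εD N-large = begin
    ∣ ι X Q.* ½ ^ℚ N - ι Y Q.* ½ ^ℚ (2 * m) ∣
      ≡⟨ cong (λ n → ∣ ι X Q.* ½ ^ℚ n - ι Y Q.* ½ ^ℚ (2 * m) ∣) N≡2m+r ⟩
    ∣ ι X Q.* ½ ^ℚ (2 * m + r) - ι Y Q.* ½ ^ℚ (2 * m) ∣
      ≤⟨ ∣prob-prob∣≤ (2 * m) r (≤-trans (X≤2^rY+bad k<m) (+-monoʳ-≤ _ bad≤gaps))
                                (≤-trans (2^rY≤X+bad k<m) (+-monoʳ-≤ _ bad≤gaps)) ⟩
    ι (Bₗ + Bₛ) Q.* ½ ^ℚ (2 * m + r)
      ≡⟨ cong (λ n → ι (Bₗ + Bₛ) Q.* ½ ^ℚ n) N≡2m+r ⟨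
    ι (Bₗ + Bₛ) Q.* ½ ^ℚ N
      ≡⟨ cong (Q._* ½ ^ℚ N) (ι-+ Bₗ Bₛ) ⟩
    (ι Bₗ Q.+ ι Bₛ) Q.* ½ ^ℚ N
      ≡⟨ Qₚ.*-distribʳ-+ (½ ^ℚ N) (ι Bₗ) (ι Bₛ) ⟩
    ι Bₗ Q.* ½ ^ℚ N Q.+ ι Bₛ Q.* ½ ^ℚ N
      ≤⟨ Qₚ.+-mono-≤ large small ⟩
    ι 4 Q.* ¾ ^ℚ (m + 1) Q.+ ε ∎
    where
    open Qₚ.≤-Reasoning
    L = m + r
    Bₗ = largeGaps N L
    Bₛ = smallGaps N L
    L≤N : L ≤ N
    L≤N = ≤-trans (m≤m+n L m) (≤-reflexive (sym N≡m+r+m))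
    bad≤gaps : bad ≤ Bₗ + Bₛ
    bad≤gaps = ≤-trans bad≤sumBelow-avoiding (≤-reflexive (sumBelow-avoiding≡large+small N L))
    large : ι Bₗ Q.* ½ ^ℚ N Q.≤ ι 4 Q.* ¾ ^ℚ (m + 1)
    large = ≤-by-scaling {Bₗ} {3 ^ suc m} {4 ^ m} N _ {{m^n≢0 4 m}}
      (subst (λ e → Bₗ * 4 ^ e ≤ 3 ^ suc e * 2 ^ N) (trans (cong (_∸ L) N≡m+r+m) (m+n∸m≡n L m))
             (largeGaps-bound N L L≤N))
      (Qₚ.≤-reflexive (ι[3^[1+n]]≡ι4*¾^[n+1]*ι[4^n] m))
    small : ι Bₛ Q.* ½ ^ℚ N Q.≤ ε
    small = ≤-by-scaling {Bₛ} {1} {D} N ε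
      (≤-trans (smallGaps-bound N L D L≤N N-large) (≤-reflexive (sym (*-identityˡ _)))) 1≤εD

open import Data.Integer using (+_)

proposition3p8 : (k m : ℕ) → k < m → (ε : ℚ) → 0ℚ Q.< ε →
  ∃ λ N → (n : ℕ) → N ≤ n →
    ∣ P n (2 * k) - f k m ∣ Q.≤ ((+ 4 / 1) Q.* (((+ 3) / 4) ^ℚ (m + 1))) Q.+ ε
proposition3p8 k m k<m ε 0<ε = 576 * D + 3 + (m + m) , bound
  where
  D = proj₁ (archimedean ε 0<ε)
  instance
    D≢0 : NonZero D
    D≢0 = proj₁ (proj₂ (archimedean ε 0<ε))
  1≤εD : ι 1 Q.≤ ε Q.* ι D
  1≤εD = proj₂ (proj₂ (archimedean ε 0<ε))
  -- 576 D + 3 is what smallGaps-bound needs; the extra 2m leaves room for r = n ∸ 2m.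
  bound : (n : ℕ) → 576 * D + 3 + (m + m) ≤ n →
    ∣ P n (2 * k) - f k m ∣ Q.≤ ((+ 4 / 1) Q.* (((+ 3) / 4) ^ℚ (m + 1))) Q.+ ε
  bound n n-large = subst (λ n → ∣ P n (2 * k) - f k m ∣ Q.≤ ι 4 Q.* ¾ ^ℚ (m + 1) Q.+ ε) N≡n
    (Coupling.∣P-f∣≤4·¾^[m+1]+ε k m r k<m D ε 1≤εD N-large)
    where
    r = n ∸ (m + m)
    2m≤n : m + m ≤ n
    2m≤n = ≤-trans (m≤n+m (m + m) (576 * D + 3)) n-large
    N≡n : Coupling.N k m r ≡ n
    N≡n = trans (layout m r) (m+[n∸m]≡n 2m≤n)
      where
      layout : ∀ m r → m + (r + (m + 0)) ≡ m + m + r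
      layout = solve-∀
    N-large : 576 * D + 3 ≤ Coupling.N k m r
    N-large = ≤-trans (m≤m+n (576 * D + 3) (m + m)) (≤-trans n-large (≤-reflexive (sym N≡n)))
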